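{- Let $n\geq 4$ and let $\mathcal{I}=(a_1,\dots,a_n)$ be an ordered irreducible signature of $Q_n$. Let $X_1,X_2$ be distinct nonempty subsets of $[n]$ and suppose $x\in X_1\cap X_2$ with $\max X_1=x$ or $\max X_2=x$. Then there exists an upright spanning tree $T$ of $Q_n$ with signature $\mathcal{I}$ such that $\psi_T(X_1)=\psi_T(X_2)=x$, unless $x=2$, $a_1=a_2=2$, and (after possibly interchanging $X_1$ and $X_2$) $X_1=\{1,2\}$ and $X_2\not\subseteq\{1,2\}$.
   Context: $[n]=\{1,\dots,n\}$. $Q_n$: vertices the subsets of $[n]$, edge between $X,Y$ iff $X\oplus Y=\{i\}$ for a single $i$ (the direction). $\mathrm{sig}(T)=(a_1,\dots,a_n)$ with $a_i$ the number of edges of the spanning tree $T$ in direction $i$; a signature of $Q_n$ is a tuple of this form; it is ordered if $a_1\le\dots\le a_n$, and irreducible if there is no proper nonempty $R\subseteq[n]$ with $\sum_{i\in R}a_i=2^{|R|}-1$. A spanning tree $T$ rooted at $\emptyset$ is upright if for each vertex $X$ the path in $T$ from $X$ to $\emptyset$ has length $|X|$; then for nonempty $X$ the next vertex on this path is $X-\{i\}$ for a unique $i$, and $\psi_T(X)=i$. -}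

module Defs where

open import Data.Nat using (ℕ; zero; suc; _+_; _∸_; _^_; _≤_)
open import Data.Bool using (Bool; true; false; if_then_else_; _∧_; not)
open import Data.Fin using (Fin; toℕ)
import Data.Fin as F
open import Data.Fin.Subset using (Subset; _∈_; _∉_; _∪_; _─_; ⁅_⁆; ∣_∣; Nonempty)
  renaming (⊥ to ∅)
open import Data.Vec using (Vec; []; _∷_; lookup; tabulate)
import Data.Vec as V
open import Data.List using (List; []; _∷_; length; map; _++_)
open import Data.Nat.ListAction using (sum)
open import Data.List.Relation.Unary.Unique.Propositional using (Unique)
open import Data.Product using (Σ; ∃; _×_; _,_)
open import Data.Sum using (_⊎_)
open import Relation.Binary.PropositionalEquality using (_≡_; _≢_)
open import Relation.Nullary using (¬_)

-- Directions 1..n of the paper are represented by Fin n (direction i ↦ index i-1);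
-- the order on directions is the order on Fin n.
-- Vertices of Q_n are subsets of [n], represented by Subset n.

allSubsets : (n : ℕ) → List (Subset n)
allSubsets zero = [] ∷ []
allSubsets (suc n) = map (true ∷_) (allSubsets n) ++ map (false ∷_) (allSubsets n)

-- An edge set of Q_n: T X i = true means that the edge {X, X ∪ {i}} of Q_n
-- (in direction i, with i ∉ X) belongs to T.  Every edge of Q_n has a unique
-- such description (X = its lower endpoint, i = its direction).
EdgeSet : ℕ → Set
EdgeSet n = Subset n → Fin n → Bool

WellFormed : ∀ {n} → EdgeSet n → Set
WellFormed {n} T = (X : Subset n) (i : Fin n) → T X i ≡ true → i ∉ X

Adj : ∀ {n} → EdgeSet n → Subset n → Subset n → Set
Adj {n} T U V =
  Σ (Fin n) λ i →
    (i ∉ U × V ≡ U ∪ ⁅ i ⁆ × T U i ≡ true) ⊎ (i ∉ V × U ≡ V ∪ ⁅ i ⁆ × T V i ≡ true)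

data IsWalk {n} (T : EdgeSet n) : Subset n → Subset n → List (Subset n) → Set where
  here : ∀ {U} → IsWalk T U U (U ∷ [])
  step : ∀ {U W V vs} → Adj T U W → IsWalk T W V vs → IsWalk T U V (U ∷ vs)

IsPath : ∀ {n} → EdgeSet n → Subset n → Subset n → List (Subset n) → Set
IsPath T U V vs = IsWalk T U V vs × Unique vs

IsSpanningTree : ∀ {n} → EdgeSet n → Set
IsSpanningTree {n} T =
  WellFormed T ×
  ((U V : Subset n) → ∃ λ vs → IsPath T U V vs) ×
  ((U V : Subset n) (vs ws : List (Subset n)) → IsPath T U V vs → IsPath T U V ws → vs ≡ ws)

sig : ∀ {n} → EdgeSet n → Fin n → ℕ
sig {n} T i = sum (map (λ X → if T X i ∧ not (lookup X i) then 1 else 0) (allSubsets n))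

-- Spanning tree T rooted at ∅ is upright: the path from X to ∅ has length |X|
-- (i.e. |X| edges, |X|+1 vertices).
IsUpright : ∀ {n} → EdgeSet n → Set
IsUpright {n} T = (X : Subset n) (vs : List (Subset n)) → IsPath T X ∅ vs → length vs ≡ suc ∣ X ∣

PsiIs : ∀ {n} → EdgeSet n → Subset n → Fin n → Set
PsiIs {n} T X x = ∃ λ rest → IsPath T X ∅ (X ∷ (X ─ ⁅ x ⁆) ∷ rest)

IsSignature : ∀ {n} → (Fin n → ℕ) → Set
IsSignature {n} a = ∃ λ (T : EdgeSet n) → IsSpanningTree T × ((i : Fin n) → sig T i ≡ a i)

IsOrdered : ∀ {n} → (Fin n → ℕ) → Set
IsOrdered {n} a = (i j : Fin n) → i F.≤ j → a i ≤ a j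

sumOver : ∀ {n} → Subset n → (Fin n → ℕ) → ℕ
sumOver {n} R a = V.sum (tabulate (λ i → if lookup R i then a i else 0))

IsIrreducible : ∀ {n} → (Fin n → ℕ) → Set
IsIrreducible {n} a =
  ¬ (Σ (Subset n) λ R → Nonempty R × (∃ λ j → j ∉ R) × sumOver R a ≡ 2 ^ ∣ R ∣ ∸ 1)

IsMax : ∀ {n} → Subset n → Fin n → Set
IsMax {n} X x = x ∈ X × ((y : Fin n) → y ∈ X → y F.≤ x)

-- X = {1,2} (indices 0,1)
Is12 : ∀ {n} → Subset n → Set
Is12 {n} X = (i : Fin n) → (i ∈ X → toℕ i ≤ 1) × (toℕ i ≤ 1 → i ∈ X)

Not⊆12 : ∀ {n} → Subset n → Set
Not⊆12 {n} X = ∃ λ (i : Fin n) → i ∈ X × 2 ≤ toℕ i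

Exceptional : ∀ {n} → (Fin n → ℕ) → Subset n → Subset n → Fin n → Set
Exceptional {n} a X₁ X₂ x =
  toℕ x ≡ 1 ×
  ((i : Fin n) → toℕ i ≤ 1 → a i ≡ 2) ×
  ((Is12 X₁ × Not⊆12 X₂) ⊎ (Is12 X₂ × Not⊆12 X₁))

-- An upright spanning tree rooted at ∅ is the same thing as a choice of ψ(X) ∈ X for every
-- nonempty X (X is joined to X − {ψ(X)}), and its signature counts the fibres of ψ.  So we
-- need such a ψ with fibre sizes aᵢ and ψ(X₁) = ψ(X₂) = x, i.e. a bipartite b-matching
-- between nonempty sets X (allowed values X, or {x} for X = X₁, X₂) and directions
-- (capacity aᵢ).  By Hall's theorem with capacities it exists iff every set S of directions
-- has capacity Σ_{i∈S} aᵢ at least the number of X whose allowed values lie in S.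
-- Since a is a signature, Σ aᵢ = 2ⁿ − 1 and Σ_{i∈S} aᵢ ≥ 2^|S| − 1 for every S (each nonempty
-- P ⊆ S owns an edge in a direction of S), with strict inequality for proper S by
-- irreducibility; the sets X₁, X₂ add at most 2 to the demand, and only when x ∈ S.
-- Hall's condition can thus only fail for an S with Σ_{i∈S} aᵢ = 2^|S|, and comparing with
-- S ∪ {y} for y ∈ X_max − S shows that this forces the exceptional configuration.
module Submission where

open import Defs
open import Data.Nat
open import Data.Nat.Properties
open import Data.Nat.ListAction using (sum)
open import Data.Nat.ListAction.Properties using (sum-++)
open import Data.Bool using (Bool; _∧_; _∨_; false; if_then_else_; not; true)
import Data.Bool as Bool
open import Data.Bool.Properties using (∨-zeroʳ; ∧-zeroʳ; ∧-identityʳ)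
open import Data.Fin using (Fin; suc; toℕ; zero)
open import Data.Fin.Properties using (toℕ-injective; any?)
open import Data.Fin.Subset using (Nonempty; Subset; _∈_; _∉_; _∩_; _∪_; _─_; ⁅_⁆; ∣_∣)
  renaming (⊥ to ∅; ⊤ to full)
open import Data.Fin.Subset.Properties
  using (x∈⁅x⁆; x∈⁅y⁆⇒x≡y; x≢y⇒x∉⁅y⁆; ∣⁅x⁆∣≡1; ∣⊥∣≡0; anySubset?; p─⊥≡p; ∪-identityʳ; ∩-zeroˡ; _∈?_)
open import Data.Vec using ([]; _∷_; lookup)
open import Data.Vec.Properties using ([]=⇒lookup; lookup⇒[]=; ∷-injectiveʳ; ≡-dec)
open import Data.List using (List; []; _++_; _∷_; allFin; length; map)
open import Data.List.Properties using (map-++; map-∘)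
open import Data.List.Membership.Propositional using () renaming (_∈_ to _∈ₗ_)
open import Data.List.Membership.Propositional.Properties
  using (∈-++⁺ʳ; ∈-++⁺ˡ; ∈-++⁻; ∈-allFin; ∈-map⁺; ∈-map⁻)
open import Data.List.Relation.Unary.Any using (here; there)
open import Data.List.Relation.Unary.All using (All; []; _∷_)
import Data.List.Relation.Unary.All as All
open import Data.List.Relation.Unary.AllPairs using ([]; _∷_)
open import Data.List.Relation.Unary.Unique.Propositional using (Unique)
import Data.List.Relation.Unary.Unique.Propositional.Properties as Unique
open import Data.Product using (_,_; _×_; proj₁; proj₂; Σ; ∃)
open import Data.Sum using (_⊎_; inj₁; inj₂; [_,_]′)
open import Data.Empty using (⊥; ⊥-elim)
open import Relation.Nullary using (Dec; no; yes; ¬_; does; _×-dec_)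
open import Relation.Nullary.Decidable using (¬?; decidable-stable; dec-true; dec-false)
open import Relation.Binary.Definitions using (DecidableEquality)
open import Relation.Binary.PropositionalEquality
open import Algebra.Properties.CommutativeSemigroup +-commutativeSemigroup using (interchange; xy∙z≈xz∙y)
open import Function using (_∘′_)

iverson : Bool → ℕ
iverson true = 1
iverson false = 0

iverson-if : ∀ b → (if b then 1 else 0) ≡ iverson b
iverson-if true = refl
iverson-if false = refl

true≢false : true ≢ false
true≢false ()

eqFin : ∀ {n} → Fin n → Fin n → Bool
eqFin zero zero = true
eqFin zero (suc j) = false
eqFin (suc i) zero = false
eqFin (suc i) (suc j) = eqFin i j

eqFin-refl : ∀ {n} (i : Fin n) → eqFin i i ≡ true
eqFin-refl zero = refl
eqFin-refl (suc i) = eqFin-refl i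

eqFin-sound : ∀ {n} (i j : Fin n) → eqFin i j ≡ true → i ≡ j
eqFin-sound zero zero e = refl
eqFin-sound (suc i) (suc j) e = cong suc (eqFin-sound i j e)

eqFin-sym : ∀ {n} (i j : Fin n) → eqFin i j ≡ eqFin j i
eqFin-sym zero zero = refl
eqFin-sym zero (suc j) = refl
eqFin-sym (suc i) zero = refl
eqFin-sym (suc i) (suc j) = eqFin-sym i j

infix 4 _≟ˢ_
_≟ˢ_ : ∀ {n} → DecidableEquality (Subset n)
_≟ˢ_ = ≡-dec Bool._≟_

eqSubset : ∀ {n} → Subset n → Subset n → Bool
eqSubset [] [] = true
eqSubset (true ∷ X) (true ∷ Y) = eqSubset X Y
eqSubset (false ∷ X) (false ∷ Y) = eqSubset X Y
eqSubset (true ∷ X) (false ∷ Y) = false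
eqSubset (false ∷ X) (true ∷ Y) = false

eqSubset-refl : ∀ {n} (X : Subset n) → eqSubset X X ≡ true
eqSubset-refl [] = refl
eqSubset-refl (true ∷ X) = eqSubset-refl X
eqSubset-refl (false ∷ X) = eqSubset-refl X

eqSubset-sound : ∀ {n} (X Y : Subset n) → eqSubset X Y ≡ true → X ≡ Y
eqSubset-sound [] [] e = refl
eqSubset-sound (true ∷ X) (true ∷ Y) e = cong (true ∷_) (eqSubset-sound X Y e)
eqSubset-sound (false ∷ X) (false ∷ Y) e = cong (false ∷_) (eqSubset-sound X Y e)

eqSubset-false : ∀ {n} (X Y : Subset n) → X ≢ Y → eqSubset X Y ≡ false
eqSubset-false X Y X≢Y with eqSubset X Y in e
... | true = ⊥-elim (X≢Y (eqSubset-sound X Y e))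
... | false = refl

isSubset : ∀ {n} → Subset n → Subset n → Bool
isSubset [] [] = true
isSubset (p ∷ P) (s ∷ S) = (not p ∨ s) ∧ isSubset P S

isSubset-sound : ∀ {n} (Z S : Subset n) → isSubset Z S ≡ true → ∀ i → lookup Z i ≡ true → lookup S i ≡ true
isSubset-sound (true ∷ Z) (true ∷ S) e zero l = refl
isSubset-sound (true ∷ Z) (true ∷ S) e (suc i) l = isSubset-sound Z S e i l
isSubset-sound (false ∷ Z) (true ∷ S) e (suc i) l = isSubset-sound Z S e i l
isSubset-sound (false ∷ Z) (false ∷ S) e (suc i) l = isSubset-sound Z S e i l

isSubset-complete : ∀ {n} (Z S : Subset n) → (∀ i → lookup Z i ≡ true → lookup S i ≡ true) → isSubset Z S ≡ true
isSubset-complete [] [] h = refl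
isSubset-complete (true ∷ Z) (s ∷ S) h rewrite h zero refl = isSubset-complete Z S (λ i → h (suc i))
isSubset-complete (false ∷ Z) (true ∷ S) h = isSubset-complete Z S (λ i → h (suc i))
isSubset-complete (false ∷ Z) (false ∷ S) h = isSubset-complete Z S (λ i → h (suc i))

isSubset-false-witness : ∀ {n} (Z S : Subset n) → isSubset Z S ≡ false →
  Σ (Fin n) λ y → lookup Z y ≡ true × lookup S y ≡ false
isSubset-false-witness [] [] ()
isSubset-false-witness (true ∷ Z) (false ∷ S) e = zero , refl , refl
isSubset-false-witness (true ∷ Z) (true ∷ S) e with isSubset-false-witness Z S e
... | y , p , q = suc y , p , q
isSubset-false-witness (false ∷ Z) (true ∷ S) e with isSubset-false-witness Z S e
... | y , p , q = suc y , p , q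
isSubset-false-witness (false ∷ Z) (false ∷ S) e with isSubset-false-witness Z S e
... | y , p , q = suc y , p , q

isSubset-∅ : ∀ {n} (S : Subset n) → isSubset ∅ S ≡ true
isSubset-∅ [] = refl
isSubset-∅ (true ∷ S) = isSubset-∅ S
isSubset-∅ (false ∷ S) = isSubset-∅ S

isSubset-⁅⁆ : ∀ {n} (x : Fin n) (S : Subset n) → isSubset ⁅ x ⁆ S ≡ lookup S x
isSubset-⁅⁆ zero (true ∷ S) = isSubset-∅ S
isSubset-⁅⁆ zero (false ∷ S) = refl
isSubset-⁅⁆ (suc x) (true ∷ S) = isSubset-⁅⁆ x S
isSubset-⁅⁆ (suc x) (false ∷ S) = isSubset-⁅⁆ x S

isSubset≡eqSubset-∩ : ∀ {n} (P S : Subset n) → isSubset P S ≡ eqSubset (P ∩ S) P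
isSubset≡eqSubset-∩ [] [] = refl
isSubset≡eqSubset-∩ (true ∷ P) (true ∷ S) = isSubset≡eqSubset-∩ P S
isSubset≡eqSubset-∩ (true ∷ P) (false ∷ S) = refl
isSubset≡eqSubset-∩ (false ∷ P) (true ∷ S) = isSubset≡eqSubset-∩ P S
isSubset≡eqSubset-∩ (false ∷ P) (false ∷ S) = isSubset≡eqSubset-∩ P S

lookup-∪ : ∀ {n} (S T : Subset n) i → lookup (S ∪ T) i ≡ (lookup S i ∨ lookup T i)
lookup-∪ (s ∷ S) (t ∷ T) zero = refl
lookup-∪ (s ∷ S) (t ∷ T) (suc i) = lookup-∪ S T i

lookup-∩ : ∀ {n} (S T : Subset n) i → lookup (S ∩ T) i ≡ (lookup S i ∧ lookup T i)
lookup-∩ (s ∷ S) (t ∷ T) zero = refl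
lookup-∩ (s ∷ S) (t ∷ T) (suc i) = lookup-∩ S T i

lookup-full : ∀ {n} (i : Fin n) → lookup (full {n}) i ≡ true
lookup-full zero = refl
lookup-full (suc i) = lookup-full i

lookup-∅ : ∀ {n} (i : Fin n) → lookup (∅ {n}) i ≡ false
lookup-∅ zero = refl
lookup-∅ (suc i) = lookup-∅ i

lookup-⁅⁆ : ∀ {n} (i j : Fin n) → lookup ⁅ j ⁆ i ≡ eqFin i j
lookup-⁅⁆ zero zero = refl
lookup-⁅⁆ zero (suc j) = refl
lookup-⁅⁆ (suc i) zero = lookup-∅ i
lookup-⁅⁆ (suc i) (suc j) = lookup-⁅⁆ i j

lookup-─-self : ∀ {n} (U : Subset n) i → lookup (U ─ ⁅ i ⁆) i ≡ false
lookup-─-self (u ∷ U) zero = refl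
lookup-─-self (u ∷ U) (suc i) = lookup-─-self U i

lookup-∪-self : ∀ {n} (U : Subset n) i → lookup (U ∪ ⁅ i ⁆) i ≡ true
lookup-∪-self (true ∷ U) zero = refl
lookup-∪-self (false ∷ U) zero = refl
lookup-∪-self (u ∷ U) (suc i) = lookup-∪-self U i

lookup-ext : ∀ {n} {X Y : Subset n} → (∀ i → lookup X i ≡ lookup Y i) → X ≡ Y
lookup-ext {X = []} {[]} h = refl
lookup-ext {X = x ∷ X} {y ∷ Y} h = cong₂ _∷_ (h zero) (lookup-ext (λ i → h (suc i)))

lookup-false⇒∉ : ∀ {n} {X : Subset n} {i} → lookup X i ≡ false → i ∉ X
lookup-false⇒∉ li i∈X = true≢false (trans (sym ([]=⇒lookup i∈X)) li)

∉⇒lookup-false : ∀ {n} {X : Subset n} {i} → i ∉ X → lookup X i ≡ false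
∉⇒lookup-false {X = X} {i} i∉X with lookup X i in e
... | true = ⊥-elim (i∉X (lookup⇒[]= i X e))
... | false = refl

lookup-true⇒≢∅ : ∀ {n} (X : Subset n) i → lookup X i ≡ true → X ≢ ∅
lookup-true⇒≢∅ X i e refl = true≢false (trans (sym e) (lookup-∅ i))

Nonempty⇒≢∅ : ∀ {n} (X : Subset n) → Nonempty X → X ≢ ∅
Nonempty⇒≢∅ X (i , i∈X) = lookup-true⇒≢∅ X i ([]=⇒lookup i∈X)

isSubset-∪ˡ : ∀ {n} (Z S T : Subset n) → isSubset Z S ≡ true → isSubset Z (S ∪ T) ≡ true
isSubset-∪ˡ Z S T e = isSubset-complete Z (S ∪ T) λ i l →
  trans (lookup-∪ S T i) (cong (_∨ lookup T i) (isSubset-sound Z S e i l))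

isSubset-∪ʳ : ∀ {n} (Z S T : Subset n) → isSubset Z T ≡ true → isSubset Z (S ∪ T) ≡ true
isSubset-∪ʳ Z S T e = isSubset-complete Z (S ∪ T) λ i l →
  trans (lookup-∪ S T i) (trans (cong (lookup S i ∨_) (isSubset-sound Z T e i l)) (∨-zeroʳ (lookup S i)))

isSubset-∩ : ∀ {n} (Z S T : Subset n) → isSubset Z S ≡ true → isSubset Z T ≡ true → isSubset Z (S ∩ T) ≡ true
isSubset-∩ Z S T e f = isSubset-complete Z (S ∩ T) λ i l →
  trans (lookup-∩ S T i) (cong₂ _∧_ (isSubset-sound Z S e i l) (isSubset-sound Z T f i l))

∪⁅⁆─⁅⁆ : ∀ {n} (U : Subset n) i → lookup U i ≡ false → (U ∪ ⁅ i ⁆) ─ ⁅ i ⁆ ≡ U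
∪⁅⁆─⁅⁆ (false ∷ U) zero e = cong (false ∷_) (trans (p─⊥≡p (U ∪ ∅)) (∪-identityʳ U))
∪⁅⁆─⁅⁆ (true ∷ U) (suc i) e = cong (true ∷_) (∪⁅⁆─⁅⁆ U i e)
∪⁅⁆─⁅⁆ (false ∷ U) (suc i) e = cong (false ∷_) (∪⁅⁆─⁅⁆ U i e)

─⁅⁆∪⁅⁆ : ∀ {n} (U : Subset n) i → lookup U i ≡ true → (U ─ ⁅ i ⁆) ∪ ⁅ i ⁆ ≡ U
─⁅⁆∪⁅⁆ (true ∷ U) zero e = cong (true ∷_) (trans (∪-identityʳ (U ─ ∅)) (p─⊥≡p U))
─⁅⁆∪⁅⁆ (true ∷ U) (suc i) e = cong (true ∷_) (─⁅⁆∪⁅⁆ U i e)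
─⁅⁆∪⁅⁆ (false ∷ U) (suc i) e = cong (false ∷_) (─⁅⁆∪⁅⁆ U i e)

∣─⁅⁆∣ : ∀ {n} (U : Subset n) i → lookup U i ≡ true → suc ∣ U ─ ⁅ i ⁆ ∣ ≡ ∣ U ∣
∣─⁅⁆∣ (true ∷ U) zero e = cong (suc ∘′ ∣_∣) (p─⊥≡p U)
∣─⁅⁆∣ (true ∷ U) (suc i) e = cong suc (∣─⁅⁆∣ U i e)
∣─⁅⁆∣ (false ∷ U) (suc i) e = ∣─⁅⁆∣ U i e

∣∪⁅⁆∣ : ∀ {n} (S : Subset n) y → lookup S y ≡ false → ∣ S ∪ ⁅ y ⁆ ∣ ≡ suc ∣ S ∣
∣∪⁅⁆∣ (false ∷ S) zero e = cong (suc ∘′ ∣_∣) (∪-identityʳ S)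
∣∪⁅⁆∣ (true ∷ S) (suc y) e = cong suc (∣∪⁅⁆∣ S y e)
∣∪⁅⁆∣ (false ∷ S) (suc y) e = ∣∪⁅⁆∣ S y e

∣S∣≡0⇒S≡∅ : ∀ {n} (U : Subset n) → ∣ U ∣ ≡ 0 → U ≡ ∅
∣S∣≡0⇒S≡∅ [] e = refl
∣S∣≡0⇒S≡∅ (false ∷ U) e = cong (false ∷_) (∣S∣≡0⇒S≡∅ U e)

S≢∅⇒∣S∣>0 : ∀ {n} (S : Subset n) → S ≢ ∅ → 1 ≤ ∣ S ∣
S≢∅⇒∣S∣>0 S S≢∅ with ∣ S ∣ in e
... | zero = ⊥-elim (S≢∅ (∣S∣≡0⇒S≡∅ S e))
... | suc k = s≤s z≤n

toggle : ∀ {n} → Fin n → Subset n → Subset n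
toggle zero (b ∷ X) = not b ∷ X
toggle (suc i) (b ∷ X) = b ∷ toggle i X

lookup-toggle-self : ∀ {n} (X : Subset n) i → lookup (toggle i X) i ≡ not (lookup X i)
lookup-toggle-self (b ∷ X) zero = refl
lookup-toggle-self (b ∷ X) (suc i) = lookup-toggle-self X i

toggle-∪⁅⁆ : ∀ {n} (X : Subset n) i → lookup X i ≡ true → toggle i X ∪ ⁅ i ⁆ ≡ X
toggle-∪⁅⁆ (true ∷ X) zero e = cong (true ∷_) (∪-identityʳ X)
toggle-∪⁅⁆ (true ∷ X) (suc i) e = cong (true ∷_) (toggle-∪⁅⁆ X i e)
toggle-∪⁅⁆ (false ∷ X) (suc i) e = cong (false ∷_) (toggle-∪⁅⁆ X i e)

eqSubset-toggle : ∀ {n} (X : Subset n) d i → eqSubset (toggle d X) (toggle i X) ≡ eqFin d i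
eqSubset-toggle (true ∷ X) zero zero = eqSubset-refl X
eqSubset-toggle (false ∷ X) zero zero = eqSubset-refl X
eqSubset-toggle (true ∷ X) zero (suc i) = refl
eqSubset-toggle (false ∷ X) zero (suc i) = refl
eqSubset-toggle (true ∷ X) (suc d) zero = refl
eqSubset-toggle (false ∷ X) (suc d) zero = refl
eqSubset-toggle (true ∷ X) (suc d) (suc i) = eqSubset-toggle X d i
eqSubset-toggle (false ∷ X) (suc d) (suc i) = eqSubset-toggle X d i

eqSubset-self-toggle : ∀ {n} (X : Subset n) i → eqSubset X (toggle i X) ≡ false
eqSubset-self-toggle (true ∷ X) zero = refl
eqSubset-self-toggle (false ∷ X) zero = refl
eqSubset-self-toggle (true ∷ X) (suc i) = eqSubset-self-toggle X i
eqSubset-self-toggle (false ∷ X) (suc i) = eqSubset-self-toggle X i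

toggle-toggle : ∀ {n} (X : Subset n) i → toggle i (toggle i X) ≡ X
toggle-toggle (true ∷ X) zero = refl
toggle-toggle (false ∷ X) zero = refl
toggle-toggle (b ∷ X) (suc i) = cong (b ∷_) (toggle-toggle X i)

toggle≡∪⁅⁆ : ∀ {n} (X : Subset n) i → lookup X i ≡ false → toggle i X ≡ X ∪ ⁅ i ⁆
toggle≡∪⁅⁆ (false ∷ X) zero e = cong (true ∷_) (sym (∪-identityʳ X))
toggle≡∪⁅⁆ (true ∷ X) (suc i) e = cong (true ∷_) (toggle≡∪⁅⁆ X i e)
toggle≡∪⁅⁆ (false ∷ X) (suc i) e = cong (false ∷_) (toggle≡∪⁅⁆ X i e)

toggle-∩ : ∀ {n} (V S : Subset n) d → lookup S d ≡ false → toggle d V ∩ S ≡ V ∩ S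
toggle-∩ (true ∷ V) (false ∷ S) zero e = refl
toggle-∩ (false ∷ V) (false ∷ S) zero e = refl
toggle-∩ (v ∷ V) (s ∷ S) (suc d) e = cong ((v ∧ s) ∷_) (toggle-∩ V S d e)


ΣS : ∀ {n} → (Subset n → ℕ) → ℕ
ΣS {zero} f = f []
ΣS {suc n} f = ΣS (λ X → f (true ∷ X)) + ΣS (λ X → f (false ∷ X))

ΣS-cong : ∀ {n} {f g : Subset n → ℕ} → (∀ X → f X ≡ g X) → ΣS f ≡ ΣS g
ΣS-cong {zero} h = h []
ΣS-cong {suc n} h = cong₂ _+_ (ΣS-cong (λ X → h (true ∷ X))) (ΣS-cong (λ X → h (false ∷ X)))

ΣS-mono : ∀ {n} {f g : Subset n → ℕ} → (∀ X → f X ≤ g X) → ΣS f ≤ ΣS g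
ΣS-mono {zero} h = h []
ΣS-mono {suc n} h = +-mono-≤ (ΣS-mono (λ X → h (true ∷ X))) (ΣS-mono (λ X → h (false ∷ X)))

ΣS-+ : ∀ {n} (f g : Subset n → ℕ) → ΣS (λ X → f X + g X) ≡ ΣS f + ΣS g
ΣS-+ {zero} f g = refl
ΣS-+ {suc n} f g = trans
  (cong₂ _+_ (ΣS-+ (λ X → f (true ∷ X)) (λ X → g (true ∷ X))) (ΣS-+ (λ X → f (false ∷ X)) (λ X → g (false ∷ X))))
  (interchange (ΣS (λ X → f (true ∷ X))) (ΣS (λ X → g (true ∷ X))) (ΣS (λ X → f (false ∷ X))) (ΣS (λ X → g (false ∷ X))))

ΣS-point : ∀ {n} (f : Subset n → ℕ) X → f X ≤ ΣS f
ΣS-point {zero} f [] = ≤-refl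
ΣS-point {suc n} f (true ∷ X) = ≤-trans (ΣS-point (λ Y → f (true ∷ Y)) X) (m≤m+n _ _)
ΣS-point {suc n} f (false ∷ X) = ≤-trans (ΣS-point (λ Y → f (false ∷ Y)) X) (m≤n+m _ _)

ΣS-0 : ∀ {n} → ΣS {n} (λ _ → 0) ≡ 0
ΣS-0 {zero} = refl
ΣS-0 {suc n} = cong₂ _+_ (ΣS-0 {n}) (ΣS-0 {n})

ΣS-if : ∀ {n} (b : Bool) (f : Subset n → ℕ) → (if b then ΣS f else 0) ≡ ΣS (λ X → if b then f X else 0)
ΣS-if true f = refl
ΣS-if {n} false f = sym (ΣS-0 {n})

ΣS-toggle : ∀ {n} (i : Fin n) (f : Subset n → ℕ) → ΣS f ≡ ΣS (λ X → f (toggle i X))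
ΣS-toggle zero f = +-comm (ΣS (λ X → f (true ∷ X))) (ΣS (λ X → f (false ∷ X)))
ΣS-toggle (suc i) f = cong₂ _+_ (ΣS-toggle i (λ X → f (true ∷ X))) (ΣS-toggle i (λ X → f (false ∷ X)))

sumOver-cong : ∀ {n} (S : Subset n) {c d : Fin n → ℕ} → (∀ i → c i ≡ d i) → sumOver S c ≡ sumOver S d
sumOver-cong [] h = refl
sumOver-cong (true ∷ S) h = cong₂ _+_ (h zero) (sumOver-cong S (λ i → h (suc i)))
sumOver-cong (false ∷ S) h = sumOver-cong S (λ i → h (suc i))

sumOver-mono : ∀ {n} (S : Subset n) {c d : Fin n → ℕ} → (∀ i → c i ≤ d i) → sumOver S c ≤ sumOver S d
sumOver-mono [] h = ≤-refl
sumOver-mono (true ∷ S) h = +-mono-≤ (h zero) (sumOver-mono S (λ i → h (suc i)))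
sumOver-mono (false ∷ S) h = sumOver-mono S (λ i → h (suc i))

sumOver-0 : ∀ {n} (S : Subset n) → sumOver S (λ _ → 0) ≡ 0
sumOver-0 [] = refl
sumOver-0 (true ∷ S) = sumOver-0 S
sumOver-0 (false ∷ S) = sumOver-0 S

sumOver-∅ : ∀ {n} (c : Fin n → ℕ) → sumOver (∅ {n}) c ≡ 0
sumOver-∅ {zero} c = refl
sumOver-∅ {suc n} c = sumOver-∅ {n} (λ i → c (suc i))

sumOver-δ : ∀ {n} (S : Subset n) (j : Fin n) (v : ℕ) →
  sumOver S (λ i → if eqFin i j then v else 0) ≡ (if lookup S j then v else 0)
sumOver-δ (true ∷ S) zero v = trans (cong (v +_) (sumOver-0 S)) (+-identityʳ v)
sumOver-δ (false ∷ S) zero v = sumOver-0 S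
sumOver-δ (true ∷ S) (suc j) v = sumOver-δ S j v
sumOver-δ (false ∷ S) (suc j) v = sumOver-δ S j v

sumOver-⁅⁆ : ∀ {n} (i : Fin n) (c : Fin n → ℕ) → sumOver ⁅ i ⁆ c ≡ c i
sumOver-⁅⁆ {suc n} zero c = trans (cong (c zero +_) (sumOver-∅ {n} (λ i → c (suc i)))) (+-identityʳ _)
sumOver-⁅⁆ (suc i) c = sumOver-⁅⁆ i (λ j → c (suc j))

sumOver-swap : ∀ {n m} (S : Subset n) (h : Subset m → Fin n → ℕ) →
  sumOver S (λ i → ΣS (λ X → h X i)) ≡ ΣS (λ X → sumOver S (λ i → h X i))
sumOver-swap {m = m} [] h = sym (ΣS-0 {m})
sumOver-swap (b ∷ S) h = begin
    (if b then ΣS (λ X → h X zero) else 0) + sumOver S (λ i → ΣS (λ X → h X (suc i)))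
      ≡⟨ cong₂ _+_ (ΣS-if b (λ X → h X zero)) (sumOver-swap S (λ X i → h X (suc i))) ⟩
    ΣS (λ X → if b then h X zero else 0) + ΣS (λ X → sumOver S (λ i → h X (suc i)))
      ≡⟨ sym (ΣS-+ (λ X → if b then h X zero else 0) (λ X → sumOver S (λ i → h X (suc i)))) ⟩
    ΣS (λ X → sumOver (b ∷ S) (λ i → h X i)) ∎
  where open ≡-Reasoning

sumOver-∪+∩ : ∀ {n} (S T : Subset n) (c : Fin n → ℕ) →
  sumOver (S ∪ T) c + sumOver (S ∩ T) c ≡ sumOver S c + sumOver T c
sumOver-∪+∩ [] [] c = refl
sumOver-∪+∩ (s ∷ S) (t ∷ T) c = begin
    (head (s ∨ t) + sumOver (S ∪ T) c′) + (head (s ∧ t) + sumOver (S ∩ T) c′)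
      ≡⟨ interchange (head (s ∨ t)) _ (head (s ∧ t)) _ ⟩
    (head (s ∨ t) + head (s ∧ t)) + (sumOver (S ∪ T) c′ + sumOver (S ∩ T) c′)
      ≡⟨ cong₂ _+_ (heads s t) (sumOver-∪+∩ S T c′) ⟩
    (head s + head t) + (sumOver S c′ + sumOver T c′)
      ≡⟨ interchange (head s) (head t) _ _ ⟩
    (head s + sumOver S c′) + (head t + sumOver T c′) ∎
  where
  open ≡-Reasoning
  c′ : Fin _ → ℕ
  c′ i = c (suc i)
  head : Bool → ℕ
  head b = if b then c zero else 0
  heads : ∀ s t → head (s ∨ t) + head (s ∧ t) ≡ head s + head t
  heads true true = refl
  heads true false = refl
  heads false true = +-comm (c zero) 0
  heads false false = refl

decrement : ∀ {n} → (Fin n → ℕ) → Fin n → Fin n → ℕ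
decrement c i j = if eqFin j i then c j ∸ 1 else c j

sumOver-decrement : ∀ {n} (S : Subset n) (c : Fin n → ℕ) (i : Fin n) → 1 ≤ c i →
  sumOver S (decrement c i) + iverson (lookup S i) ≡ sumOver S c
sumOver-decrement (true ∷ S) c zero h = begin
    ((c zero ∸ 1) + sumOver S (λ j → c (suc j))) + 1 ≡⟨ +-comm _ 1 ⟩
    suc ((c zero ∸ 1) + sumOver S (λ j → c (suc j))) ≡⟨ cong (_+ sumOver S (λ j → c (suc j))) (m+[n∸m]≡n h) ⟩
    c zero + sumOver S (λ j → c (suc j)) ∎
  where open ≡-Reasoning
sumOver-decrement (false ∷ S) c zero h = +-identityʳ _
sumOver-decrement (true ∷ S) c (suc i) h = trans (+-assoc (c zero) _ _) (cong (c zero +_) (sumOver-decrement S (λ j → c (suc j)) i h))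
sumOver-decrement (false ∷ S) c (suc i) h = sumOver-decrement S (λ j → c (suc j)) i h

sumOver-full-0 : ∀ {n} (c : Fin n → ℕ) → sumOver (full {n}) c ≡ 0 → ∀ j → c j ≡ 0
sumOver-full-0 {suc n} c e zero = m+n≡0⇒m≡0 (c zero) e
sumOver-full-0 {suc n} c e (suc j) = sumOver-full-0 (λ i → c (suc i)) (m+n≡0⇒n≡0 (c zero) e) j

sum-allSubsets : ∀ n (f : Subset n → ℕ) → sum (map f (allSubsets n)) ≡ ΣS f
sum-allSubsets zero f = +-identityʳ _
sum-allSubsets (suc n) f = begin
    sum (map f (map (true ∷_) A ++ map (false ∷_) A))
      ≡⟨ cong sum (map-++ f (map (true ∷_) A) (map (false ∷_) A)) ⟩
    sum (map f (map (true ∷_) A) ++ map f (map (false ∷_) A))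
      ≡⟨ sum-++ (map f (map (true ∷_) A)) _ ⟩
    sum (map f (map (true ∷_) A)) + sum (map f (map (false ∷_) A))
      ≡⟨ cong₂ _+_ (cong sum (sym (map-∘ A))) (cong sum (sym (map-∘ A))) ⟩
    sum (map (λ X → f (true ∷ X)) A) + sum (map (λ X → f (false ∷ X)) A)
      ≡⟨ cong₂ _+_ (sum-allSubsets n _) (sum-allSubsets n _) ⟩
    ΣS f ∎
  where
  open ≡-Reasoning
  A = allSubsets n

nonemptySubsets : (n : ℕ) → List (Subset n)
nonemptySubsets zero = []
nonemptySubsets (suc n) = map (true ∷_) (allSubsets n) ++ map (false ∷_) (nonemptySubsets n)

sum-nonemptySubsets : ∀ n (f : Subset n → ℕ) → sum (map f (nonemptySubsets n)) + f ∅ ≡ ΣS f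
sum-nonemptySubsets zero f = refl
sum-nonemptySubsets (suc n) f = begin
    sum (map f (map (true ∷_) A ++ map (false ∷_) B)) + f (false ∷ ∅)
      ≡⟨ cong (_+ f (false ∷ ∅)) (trans (cong sum (map-++ f (map (true ∷_) A) (map (false ∷_) B))) (sum-++ (map f (map (true ∷_) A)) _)) ⟩
    (sum (map f (map (true ∷_) A)) + sum (map f (map (false ∷_) B))) + f (false ∷ ∅)
      ≡⟨ +-assoc (sum (map f (map (true ∷_) A))) _ _ ⟩
    sum (map f (map (true ∷_) A)) + (sum (map f (map (false ∷_) B)) + f (false ∷ ∅))
      ≡⟨ cong₂ (λ u v → sum u + (sum v + f (false ∷ ∅))) (sym (map-∘ A)) (sym (map-∘ B)) ⟩
    sum (map (λ X → f (true ∷ X)) A) + (sum (map (λ X → f (false ∷ X)) B) + f (false ∷ ∅))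
      ≡⟨ cong₂ _+_ (sum-allSubsets n _) (sum-nonemptySubsets n (λ X → f (false ∷ X))) ⟩
    ΣS f ∎
  where
  open ≡-Reasoning
  A = allSubsets n
  B = nonemptySubsets n

sum-cong-∈ : ∀ {A : Set} (F : List A) {f g : A → ℕ} → (∀ Y → Y ∈ₗ F → f Y ≡ g Y) → sum (map f F) ≡ sum (map g F)
sum-cong-∈ [] h = refl
sum-cong-∈ (x ∷ F) h = cong₂ _+_ (h x (here refl)) (sum-cong-∈ F (λ Y m → h Y (there m)))


∈-allSubsets : ∀ n (X : Subset n) → X ∈ₗ allSubsets n
∈-allSubsets zero [] = here refl
∈-allSubsets (suc n) (true ∷ X) = ∈-++⁺ˡ (∈-map⁺ (true ∷_) (∈-allSubsets n X))
∈-allSubsets (suc n) (false ∷ X) = ∈-++⁺ʳ (map (true ∷_) (allSubsets n)) (∈-map⁺ (false ∷_) (∈-allSubsets n X))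

∈-nonemptySubsets : ∀ n (X : Subset n) → X ≢ ∅ → X ∈ₗ nonemptySubsets n
∈-nonemptySubsets zero [] ne = ⊥-elim (ne refl)
∈-nonemptySubsets (suc n) (true ∷ X) ne = ∈-++⁺ˡ (∈-map⁺ (true ∷_) (∈-allSubsets n X))
∈-nonemptySubsets (suc n) (false ∷ X) ne = ∈-++⁺ʳ (map (true ∷_) (allSubsets n)) (∈-map⁺ (false ∷_) (∈-nonemptySubsets n X (λ e → ne (cong (false ∷_) e))))

nonemptySubsets-≢∅ : ∀ n (X : Subset n) → X ∈ₗ nonemptySubsets n → X ≢ ∅
nonemptySubsets-≢∅ zero X ()
nonemptySubsets-≢∅ (suc n) X m with ∈-++⁻ (map (true ∷_) (allSubsets n)) m
... | inj₁ m1 with ∈-map⁻ (true ∷_) m1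
...   | Y , _ , refl = λ ()
nonemptySubsets-≢∅ (suc n) X m | inj₂ m2 with ∈-map⁻ (false ∷_) m2
...   | Y , mY , refl = λ e → nonemptySubsets-≢∅ n Y mY (∷-injectiveʳ e)

allSubsets-unique : ∀ n → Unique (allSubsets n)
allSubsets-unique zero = [] ∷ []
allSubsets-unique (suc n) = Unique.++⁺ (Unique.map⁺ ∷-injectiveʳ (allSubsets-unique n)) (Unique.map⁺ ∷-injectiveʳ (allSubsets-unique n)) disj
  where
  disj : ∀ {v} → ¬ (v ∈ₗ map (true ∷_) (allSubsets n) × v ∈ₗ map (false ∷_) (allSubsets n))
  disj (m1 , m2) with ∈-map⁻ (true ∷_) m1 | ∈-map⁻ (false ∷_) m2
  ... | _ , _ , refl | _ , _ , ()

nonemptySubsets-unique : ∀ n → Unique (nonemptySubsets n)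
nonemptySubsets-unique zero = []
nonemptySubsets-unique (suc n) = Unique.++⁺ (Unique.map⁺ ∷-injectiveʳ (allSubsets-unique n)) (Unique.map⁺ ∷-injectiveʳ (nonemptySubsets-unique n)) disj
  where
  disj : ∀ {v} → ¬ (v ∈ₗ map (true ∷_) (allSubsets n) × v ∈ₗ map (false ∷_) (nonemptySubsets n))
  disj (m1 , m2) with ∈-map⁻ (true ∷_) m1 | ∈-map⁻ (false ∷_) m2
  ... | _ , _ , refl | _ , _ , ()

length≡sum-map-1 : ∀ {A : Set} (L : List A) → length L ≡ sum (map (λ _ → 1) L)
length≡sum-map-1 [] = refl
length≡sum-map-1 (x ∷ L) = cong suc (length≡sum-map-1 L)

ΣS-swap : ∀ {n m} (g : Subset n → Subset m → ℕ) → ΣS (λ P → ΣS (λ X → g P X)) ≡ ΣS (λ X → ΣS (λ P → g P X))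
ΣS-swap {zero} g = refl
ΣS-swap {suc n} g = trans (cong₂ _+_ (ΣS-swap (λ P X → g (true ∷ P) X)) (ΣS-swap (λ P X → g (false ∷ P) X)))
  (sym (ΣS-+ (λ X → ΣS (λ P → g (true ∷ P) X)) (λ X → ΣS (λ P → g (false ∷ P) X))))

ΣS-δ : ∀ {n} (Q : Subset n) (v : ℕ) → ΣS (λ P → iverson (eqSubset Q P) * v) ≡ v
ΣS-δ [] v = +-identityʳ v
ΣS-δ {suc n} (true ∷ Q) v = trans (cong₂ _+_ (ΣS-δ Q v) (ΣS-0 {n})) (+-identityʳ v)
ΣS-δ {suc n} (false ∷ Q) v = trans (cong (_+ ΣS (λ P → iverson (eqSubset Q P) * v)) (ΣS-0 {n})) (ΣS-δ Q v)

ΣS-fibres : ∀ {n} (π : Subset n → Subset n) (f : Subset n → ℕ) → ΣS f ≡ ΣS (λ P → ΣS (λ X → iverson (eqSubset (π X) P) * f X))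
ΣS-fibres π f = sym (trans (ΣS-swap (λ P X → iverson (eqSubset (π X) P) * f X)) (ΣS-cong (λ X → ΣS-δ (π X) (f X))))

ΣS-⊆ : ∀ {n} (S : Subset n) → ΣS (λ P → iverson (eqSubset (P ∩ S) P)) ≡ 2 ^ ∣ S ∣
ΣS-⊆ [] = refl
ΣS-⊆ {suc n} (true ∷ S) = trans (cong₂ _+_ (ΣS-⊆ S) (ΣS-⊆ S)) (cong (2 ^ ∣ S ∣ +_) (sym (+-identityʳ _)))
ΣS-⊆ {suc n} (false ∷ S) = trans (cong (_+ ΣS (λ P → iverson (eqSubset (P ∩ S) P))) (ΣS-0 {n})) (ΣS-⊆ S)

ΣS-nonempty-⊆ : ∀ {n} (S : Subset n) → ΣS (λ P → iverson (eqSubset (P ∩ S) P ∧ not (eqSubset ∅ P))) + 1 ≡ 2 ^ ∣ S ∣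
ΣS-nonempty-⊆ {n} S = begin
    ΣS nonempty⊆ + 1          ≡⟨ cong (ΣS nonempty⊆ +_) (ΣS-δ (∅ {n}) 1) ⟨
    ΣS nonempty⊆ + ΣS empty   ≡⟨ ΣS-+ nonempty⊆ empty ⟨
    ΣS (λ P → nonempty⊆ P + empty P) ≡⟨ ΣS-cong split ⟩
    ΣS (λ P → iverson (eqSubset (P ∩ S) P)) ≡⟨ ΣS-⊆ S ⟩
    2 ^ ∣ S ∣ ∎
  where
  open ≡-Reasoning
  nonempty⊆ empty : Subset n → ℕ
  nonempty⊆ P = iverson (eqSubset (P ∩ S) P ∧ not (eqSubset ∅ P))
  empty P = iverson (eqSubset ∅ P) * 1
  split : ∀ P → nonempty⊆ P + empty P ≡ iverson (eqSubset (P ∩ S) P)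
  split P with eqSubset ∅ P in e
  ... | true rewrite sym (eqSubset-sound ∅ P e) | ∩-zeroˡ S | eqSubset-refl (∅ {n}) = refl
  ... | false rewrite ∧-identityʳ (eqSubset (P ∩ S) P) = +-identityʳ _

sum-map-+ : ∀ {A : Set} (L : List A) (f g : A → ℕ) → sum (map (λ Y → f Y + g Y) L) ≡ sum (map f L) + sum (map g L)
sum-map-+ [] f g = refl
sum-map-+ (y ∷ L) f g = trans (cong (f y + g y +_) (sum-map-+ L f g)) (interchange (f y) (g y) _ _)

sum-map-* : ∀ {A : Set} (L : List A) (f : A → ℕ) (w : ℕ) → sum (map (λ Y → f Y * w) L) ≡ sum (map f L) * w
sum-map-* [] f w = refl
sum-map-* (y ∷ L) f w = trans (cong (f y * w +_) (sum-map-* L f w)) (sym (*-distribʳ-+ w (f y) _))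

sum-mono-∈ : ∀ {A : Set} (L : List A) {f g : A → ℕ} → (∀ Y → Y ∈ₗ L → f Y ≤ g Y) → sum (map f L) ≤ sum (map g L)
sum-mono-∈ [] h = ≤-refl
sum-mono-∈ (y ∷ L) h = +-mono-≤ (h y (here refl)) (sum-mono-∈ L (λ Y m → h Y (there m)))

sum-eqSubset-∉ : ∀ {n} (L : List (Subset n)) Z → All (Z ≢_) L → sum (map (λ Y → iverson (eqSubset Y Z)) L) ≡ 0
sum-eqSubset-∉ [] Z al = refl
sum-eqSubset-∉ (y ∷ L) Z (p ∷ al) rewrite eqSubset-false y Z (λ e → p (sym e)) = sum-eqSubset-∉ L Z al

sum-eqSubset-unique : ∀ {n} (L : List (Subset n)) Z → Unique L → sum (map (λ Y → iverson (eqSubset Y Z)) L) ≤ 1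
sum-eqSubset-unique [] Z u = z≤n
sum-eqSubset-unique (y ∷ L) Z (al ∷ u) with eqSubset y Z in e
... | true rewrite eqSubset-sound y Z e | sum-eqSubset-∉ L Z al = ≤-refl
... | false = sum-eqSubset-unique L Z u

sum-nonemptySubsets-⊆ : ∀ n (S : Subset n) → sum (map (λ Y → iverson (isSubset Y S)) (nonemptySubsets n)) + 1 ≡ 2 ^ ∣ S ∣
sum-nonemptySubsets-⊆ n S = begin
    sum (map ⊆S (nonemptySubsets n)) + 1      ≡⟨ cong (λ b → sum (map ⊆S (nonemptySubsets n)) + iverson b) (isSubset-∅ S) ⟨
    sum (map ⊆S (nonemptySubsets n)) + ⊆S ∅   ≡⟨ sum-nonemptySubsets n ⊆S ⟩
    ΣS ⊆S                                     ≡⟨ ΣS-cong (λ P → cong iverson (isSubset≡eqSubset-∩ P S)) ⟩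
    ΣS (λ P → iverson (eqSubset (P ∩ S) P))   ≡⟨ ΣS-⊆ S ⟩
    2 ^ ∣ S ∣                                 ∎
  where
  open ≡-Reasoning
  ⊆S : Subset n → ℕ
  ⊆S Y = iverson (isSubset Y S)

∀⊎∃¬-Subset : ∀ {n} {P : Subset n → Set} → (∀ S → Dec (P S)) → (∀ S → P S) ⊎ ∃ λ S → ¬ P S
∀⊎∃¬-Subset P? with anySubset? (λ S → ¬? (P? S))
... | yes ∃¬P = inj₂ ∃¬P
... | no ¬∃¬P = inj₁ λ S → decidable-stable (P? S) (λ ¬PS → ¬∃¬P (S , ¬PS))

module Hall {D : Set} (_≟_ : DecidableEquality D) {n : ℕ} (A : D → Subset n) where

  demand : List D → Subset n → ℕ
  demand F S = sum (map (λ X → iverson (isSubset (A X) S)) F)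

  HallCondition : List D → (Fin n → ℕ) → Set
  HallCondition F c = ∀ S → demand F S ≤ sumOver S c

  load : (D → Fin n) → List D → Fin n → ℕ
  load ψ F j = sum (map (λ X → iverson (eqFin (ψ X) j)) F)

  demand-supermodular : ∀ F S T → demand F S + demand F T ≤ demand F (S ∪ T) + demand F (S ∩ T)
  demand-supermodular [] S T = ≤-refl
  demand-supermodular (X ∷ F) S T = begin
      (⊆ S + demand F S) + (⊆ T + demand F T)
        ≡⟨ interchange (⊆ S) _ (⊆ T) _ ⟩
      (⊆ S + ⊆ T) + (demand F S + demand F T)
        ≤⟨ +-mono-≤ (head (isSubset (A X) S) (isSubset (A X) T) refl refl) (demand-supermodular F S T) ⟩
      (⊆ (S ∪ T) + ⊆ (S ∩ T)) + (demand F (S ∪ T) + demand F (S ∩ T))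
        ≡⟨ interchange (⊆ (S ∪ T)) (⊆ (S ∩ T)) _ _ ⟩
      (⊆ (S ∪ T) + demand F (S ∪ T)) + (⊆ (S ∩ T) + demand F (S ∩ T)) ∎
    where
    open ≤-Reasoning
    ⊆ : Subset n → ℕ
    ⊆ U = iverson (isSubset (A X) U)
    head : ∀ s t → isSubset (A X) S ≡ s → isSubset (A X) T ≡ t → iverson s + iverson t ≤ ⊆ (S ∪ T) + ⊆ (S ∩ T)
    head true true eS eT rewrite isSubset-∪ˡ (A X) S T eS | isSubset-∩ (A X) S T eS eT = ≤-refl
    head true false eS eT rewrite isSubset-∪ˡ (A X) S T eS = s≤s z≤n
    head false true eS eT rewrite isSubset-∪ʳ (A X) S T eT = s≤s z≤n
    head false false eS eT = z≤n

  Tight : List D → (Fin n → ℕ) → Subset n → Set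
  Tight F c S = sumOver S c ≤ demand F S

  tight-∪ : ∀ F c → HallCondition F c → ∀ S T → Tight F c S → Tight F c T → Tight F c (S ∪ T)
  tight-∪ F c hc S T tS tT = +-cancelʳ-≤ (sumOver (S ∩ T) c) _ _ (begin
      sumOver (S ∪ T) c + sumOver (S ∩ T) c ≡⟨ sumOver-∪+∩ S T c ⟩
      sumOver S c + sumOver T c             ≤⟨ +-mono-≤ tS tT ⟩
      demand F S + demand F T               ≤⟨ demand-supermodular F S T ⟩
      demand F (S ∪ T) + demand F (S ∩ T)   ≤⟨ +-monoʳ-≤ (demand F (S ∪ T)) (hc (S ∩ T)) ⟩
      demand F (S ∪ T) + sumOver (S ∩ T) c  ∎)
    where open ≤-Reasoning

  Assignable : List D → (Fin n → ℕ) → D → Fin n → Set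
  Assignable F c X i = lookup (A X) i ≡ true × 1 ≤ c i × HallCondition F (decrement c i)

  assignable? : ∀ F c X i → Dec (Assignable F c X i)
  assignable? F c X i with lookup (A X) i Bool.≟ true | 1 ≤? c i
    | ∀⊎∃¬-Subset (λ S → demand F S ≤? sumOver S (decrement c i))
  ... | yes p | yes q | inj₁ r = yes (p , q , r)
  ... | no ¬p | _ | _ = no λ z → ¬p (proj₁ z)
  ... | _ | no ¬q | _ = no λ z → ¬q (proj₁ (proj₂ z))
  ... | _ | _ | inj₂ (S , ¬r) = no λ z → ¬r (proj₂ (proj₂ z) S)

  unassignable⇒tight : ∀ F c X i → HallCondition F c → lookup (A X) i ≡ true → ¬ Assignable F c X i →
                       ∃ λ S → Tight F c S × lookup S i ≡ true
  unassignable⇒tight F c X i hc i∈AX ¬ok with 1 ≤? c i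
  ... | no ci≯0 = ⁅ i ⁆ , ≤-trans (≤-reflexive (sumOver-⁅⁆ i c)) (≤-trans (≤-pred (≰⇒> ci≯0)) z≤n) ,
                  trans (lookup-⁅⁆ i i) (eqFin-refl i)
  ... | yes ci>0 with ∀⊎∃¬-Subset (λ S → demand F S ≤? sumOver S (decrement c i))
  ...   | inj₁ hc′ = ⊥-elim (¬ok (i∈AX , ci>0 , hc′))
  ...   | inj₂ (S , ¬hc′) with lookup S i in eSi
  ...     | true = S , tight , eSi
    where
    open ≤-Reasoning
    tight : Tight F c S
    tight = begin
      sumOver S c                                      ≡⟨ sumOver-decrement S c i ci>0 ⟨
      sumOver S (decrement c i) + iverson (lookup S i) ≡⟨ cong (λ b → sumOver S (decrement c i) + iverson b) eSi ⟩
      sumOver S (decrement c i) + 1                    ≡⟨ +-comm _ 1 ⟩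
      suc (sumOver S (decrement c i))                  ≤⟨ ≰⇒> ¬hc′ ⟩
      demand F S                                       ∎
  ...     | false = ⊥-elim (¬hc′ (≤-trans (hc S) (≤-reflexive (begin
      sumOver S c                                      ≡⟨ sumOver-decrement S c i ci>0 ⟨
      sumOver S (decrement c i) + iverson (lookup S i) ≡⟨ cong (λ b → sumOver S (decrement c i) + iverson b) eSi ⟩
      sumOver S (decrement c i) + 0                    ≡⟨ +-identityʳ _ ⟩
      sumOver S (decrement c i)                        ∎))))
    where open ≡-Reasoning

  tight-cover : ∀ F c X → HallCondition F c → (∀ i → lookup (A X) i ≡ true → ∃ λ S → Tight F c S × lookup S i ≡ true) →
                ∃ λ U → Tight F c U × isSubset (A X) U ≡ true
  tight-cover F c X hc tight-at with cover (allFin n)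
    where
    cover : (L : List (Fin n)) → ∃ λ U → Tight F c U × (∀ i → i ∈ₗ L → lookup (A X) i ≡ true → lookup U i ≡ true)
    cover [] = ∅ , ≤-trans (≤-reflexive (sumOver-∅ c)) z≤n , λ i ()
    cover (i ∷ L) with lookup (A X) i in eAi | cover L
    ... | false | U , tU , U⊇ = U , tU , λ { j (here refl) l → ⊥-elim (true≢false (trans (sym l) eAi)) ; j (there m) l → U⊇ j m l }
    ... | true | U , tU , U⊇ with tight-at i eAi
    ...   | S , tS , i∈S = S ∪ U , tight-∪ F c hc S U tS tU ,
            λ { j (here refl) l → trans (lookup-∪ S U j) (cong (_∨ lookup U j) i∈S)
              ; j (there m) l → trans (lookup-∪ S U j) (trans (cong (lookup S j ∨_) (U⊇ j m l)) (∨-zeroʳ (lookup S j))) }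
  ... | U , tU , U⊇ = U , tU , isSubset-complete (A X) U (λ i l → U⊇ i (∈-allFin i) l)

  -- If no i were assignable, every i ∈ A X would lie in a tight set; tight sets are closed
  -- under ∪, and one containing A X violates Hall's condition for X ∷ F.
  some-assignable : ∀ F c X → HallCondition (X ∷ F) c → ∃ (Assignable F c X)
  some-assignable F c X hc with any? (assignable? F c X)
  ... | yes ok = ok
  ... | no none with tight-cover F c X hcF (λ i i∈AX → unassignable⇒tight F c X i hcF i∈AX (λ ok → none (i , ok)))
    where
    hcF : HallCondition F c
    hcF S = ≤-trans (m≤n+m (demand F S) _) (hc S)
  ...   | U , tU , AX⊆U = ⊥-elim (1+n≰n (≤-trans (subst (λ b → iverson b + demand F U ≤ sumOver U c) AX⊆U (hc U)) tU))

  assign : D → Fin n → (D → Fin n) → D → Fin n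
  assign X i ψ Y = if does (Y ≟ X) then i else ψ Y

  assign-≢ : ∀ X i ψ {Y} → Y ≢ X → assign X i ψ Y ≡ ψ Y
  assign-≢ X i ψ {Y} Y≢X rewrite dec-false (Y ≟ X) Y≢X = refl

  assign-self : ∀ X i ψ → assign X i ψ X ≡ i
  assign-self X i ψ rewrite dec-true (X ≟ X) refl = refl

  load-assign : ∀ X i ψ F → All (X ≢_) F → ∀ j → load (assign X i ψ) (X ∷ F) j ≡ iverson (eqFin i j) + load ψ F j
  load-assign X i ψ F X∉F j = cong₂ _+_ (cong (λ k → iverson (eqFin k j)) (assign-self X i ψ))
    (sum-cong-∈ F (λ Y Y∈F → cong (λ k → iverson (eqFin k j)) (assign-≢ X i ψ (λ Y≡X → All.lookup X∉F Y∈F (sym Y≡X)))))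

  iverson+decrement : ∀ (c : Fin n → ℕ) i j → 1 ≤ c i → iverson (eqFin i j) + decrement c i j ≡ c j
  iverson+decrement c i j ci>0 with eqFin j i in e
  ... | true rewrite eqFin-sound j i e | eqFin-refl i = m+[n∸m]≡n ci>0
  ... | false rewrite eqFin-sym i j | e = refl

  hall : Fin n → (F : List D) → Unique F → (c : Fin n → ℕ) → HallCondition F c → sumOver full c ≡ length F →
         Σ (D → Fin n) λ ψ → (∀ X → X ∈ₗ F → lookup (A X) (ψ X) ≡ true) × (∀ j → load ψ F j ≡ c j)
  hall default [] _ c _ Σc≡0 = (λ _ → default) , (λ X ()) , λ j → sym (sumOver-full-0 c Σc≡0 j)
  hall default (X ∷ F) (X∉F ∷ uF) c hc Σc≡ with some-assignable F c X hc
  ... | i , i∈AX , ci>0 , hc′ with hall default F uF (decrement c i) hc′ Σc′≡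
    where
    Σc′≡ : sumOver full (decrement c i) ≡ length F
    Σc′≡ = +-cancelʳ-≡ 1 _ _ (begin
      sumOver full (decrement c i) + 1                       ≡⟨ cong (λ b → sumOver full (decrement c i) + iverson b) (lookup-full i) ⟨
      sumOver full (decrement c i) + iverson (lookup full i) ≡⟨ sumOver-decrement full c i ci>0 ⟩
      sumOver full c                                         ≡⟨ Σc≡ ⟩
      suc (length F)                                         ≡⟨ +-comm 1 (length F) ⟩
      length F + 1                                           ∎)
      where open ≡-Reasoning
  ...   | ψ , ψ∈A , loadψ = assign X i ψ , ∈A , load≡
    where
    ∈A : ∀ Y → Y ∈ₗ X ∷ F → lookup (A Y) (assign X i ψ Y) ≡ true
    ∈A Y (here refl) rewrite assign-self X i ψ = i∈AX
    ∈A Y (there Y∈F) rewrite assign-≢ X i ψ (λ Y≡X → All.lookup X∉F Y∈F (sym Y≡X)) = ψ∈A Y Y∈F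
    load≡ : ∀ j → load (assign X i ψ) (X ∷ F) j ≡ c j
    load≡ j = trans (load-assign X i ψ F X∉F j) (trans (cong (iverson (eqFin i j) +_) (loadψ j)) (iverson+decrement c i j ci>0))

module Walks {n : ℕ} (T : EdgeSet n) where

  Adj-sym : ∀ {U V} → Adj T U V → Adj T V U
  Adj-sym (i , inj₁ x) = i , inj₂ x
  Adj-sym (i , inj₂ y) = i , inj₁ y

  walk-head : ∀ {U V vs} → IsWalk T U V vs → ∃ λ rest → vs ≡ U ∷ rest
  walk-head here = [] , refl
  walk-head (step _ _) = _ , refl

  walk-last : ∀ {U V vs} → IsWalk T U V vs → V ∈ₗ vs
  walk-last here = here refl
  walk-last (step _ w) = there (walk-last w)

  walk-++ : ∀ {U V W vs ws} → IsWalk T U V vs → IsWalk T V W ws → ∃ (IsWalk T U W)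
  walk-++ here w = _ , w
  walk-++ (step a v) w = _ , step a (proj₂ (walk-++ v w))

  walk-reverse : ∀ {U V vs} → IsWalk T U V vs → ∃ (IsWalk T V U)
  walk-reverse here = _ , here
  walk-reverse (step a w) = walk-++ (proj₂ (walk-reverse w)) (step (Adj-sym a) here)

  ∈⊎All≢ : (U : Subset n) (ps : List (Subset n)) → U ∈ₗ ps ⊎ All (U ≢_) ps
  ∈⊎All≢ U [] = inj₂ []
  ∈⊎All≢ U (p ∷ ps) with U ≟ˢ p
  ... | yes U≡p = inj₁ (here U≡p)
  ... | no U≢p with ∈⊎All≢ U ps
  ...   | inj₁ U∈ps = inj₁ (there U∈ps)
  ...   | inj₂ U∉ps = inj₂ (U≢p ∷ U∉ps)

  path-suffix : ∀ {U W V ps} → IsWalk T W V ps → Unique ps → U ∈ₗ ps →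
                ∃ λ qs → IsPath T U V qs × (∀ {Z} → Z ∈ₗ qs → Z ∈ₗ ps)
  path-suffix here u (here refl) = _ , (here , u) , λ m → m
  path-suffix (step a w) u (here refl) = _ , (step a w , u) , λ m → m
  path-suffix (step a w) (_ ∷ u) (there m) with path-suffix w u m
  ... | qs , q , qs⊆ = qs , q , λ m′ → there (qs⊆ m′)

  walk⇒path : ∀ {U V vs} → IsWalk T U V vs → ∃ (IsPath T U V)
  walk⇒path here = _ , here , ([] ∷ [])
  walk⇒path {U} (step a w) with walk⇒path w
  ... | ps , wp , up with ∈⊎All≢ U ps
  ...   | inj₁ U∈ps = let qs , q , _ = path-suffix wp up U∈ps in qs , q
  ...   | inj₂ U∉ps = U ∷ ps , step a wp , (U∉ps ∷ up)

∅─ : ∀ {n} (Z : Subset n) → ∅ ─ Z ≡ ∅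
∅─ [] = refl
∅─ (true ∷ Z) = cong (false ∷_) (∅─ Z)
∅─ (false ∷ Z) = cong (false ∷_) (∅─ Z)

ParentChoice : ℕ → Set
ParentChoice n = Σ (Subset n → Fin n) λ ψ → (Y : Subset n) → Y ≢ ∅ → lookup Y (ψ Y) ≡ true

module UprightTree {n : ℕ} (choice : ParentChoice n) where

  ψ : Subset n → Fin n
  ψ = proj₁ choice

  ψ∈ : (Y : Subset n) → Y ≢ ∅ → lookup Y (ψ Y) ≡ true
  ψ∈ = proj₂ choice

  -- Every nonempty Y is joined to its parent Y − {ψ Y}.
  tree : EdgeSet n
  tree X i = not (lookup X i) ∧ eqFin (ψ (X ∪ ⁅ i ⁆)) i

  open Walks tree

  parent : Subset n → Subset n
  parent Y = Y ─ ⁅ ψ Y ⁆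

  tree-wellFormed : WellFormed tree
  tree-wellFormed X i e i∈X with lookup X i | []=⇒lookup i∈X | e
  ... | true | _ | ()

  edge⇒parent : ∀ {U i} → i ∉ U → tree U i ≡ true → U ≡ parent (U ∪ ⁅ i ⁆)
  edge⇒parent {U} {i} i∉U e with lookup U i in eUi
  ... | true = ⊥-elim (i∉U (lookup⇒[]= i U eUi))
  ... | false rewrite eqFin-sound (ψ (U ∪ ⁅ i ⁆)) i e = sym (∪⁅⁆─⁅⁆ U i eUi)

  Adj⇒parent : ∀ {U W} → Adj tree U W → (W ≡ parent U × U ≢ ∅) ⊎ (U ≡ parent W × W ≢ ∅)
  Adj⇒parent {U} (i , inj₁ (i∉U , refl , e)) =
    inj₂ (edge⇒parent i∉U e , lookup-true⇒≢∅ (U ∪ ⁅ i ⁆) i (lookup-∪-self U i))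
  Adj⇒parent {W = W} (i , inj₂ (i∉W , refl , e)) =
    inj₁ (edge⇒parent i∉W e , lookup-true⇒≢∅ (W ∪ ⁅ i ⁆) i (lookup-∪-self W i))

  Adj-parent : ∀ Y → Y ≢ ∅ → Adj tree Y (parent Y)
  Adj-parent Y Y≢∅ = ψ Y , inj₂ (lookup-false⇒∉ (lookup-─-self Y (ψ Y)) , sym (─⁅⁆∪⁅⁆ Y (ψ Y) (ψ∈ Y Y≢∅)) , edge)
    where
    edge : tree (parent Y) (ψ Y) ≡ true
    edge rewrite lookup-─-self Y (ψ Y) | ─⁅⁆∪⁅⁆ Y (ψ Y) (ψ∈ Y Y≢∅) = eqFin-refl (ψ Y)

  ∣parent∣ : ∀ Y → ∣ parent Y ∣ ≡ ∣ Y ∣ ∸ 1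
  ∣parent∣ Y with Y ≟ˢ ∅
  ... | yes refl rewrite ∅─ ⁅ ψ (∅ {n}) ⁆ | ∣⊥∣≡0 n = refl
  ... | no Y≢∅ = cong (_∸ 1) (∣─⁅⁆∣ Y (ψ Y) (ψ∈ Y Y≢∅))

  ∣child∣ : ∀ {U Y} → U ≡ parent Y → Y ≢ ∅ → ∣ Y ∣ ≡ suc ∣ U ∣
  ∣child∣ {U} {Y} refl Y≢∅ = begin
    ∣ Y ∣               ≡⟨ m∸n+n≡m (S≢∅⇒∣S∣>0 Y Y≢∅) ⟨
    ∣ Y ∣ ∸ 1 + 1       ≡⟨ +-comm _ 1 ⟩
    suc (∣ Y ∣ ∸ 1)     ≡⟨ cong suc (∣parent∣ Y) ⟨
    suc ∣ parent Y ∣    ∎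
    where open ≡-Reasoning

  parentⁿ : ℕ → Subset n → Subset n
  parentⁿ zero Y = Y
  parentⁿ (suc k) Y = parent (parentⁿ k Y)

  parentⁿ-suc : ∀ k Y → parentⁿ (suc k) Y ≡ parentⁿ k (parent Y)
  parentⁿ-suc zero Y = refl
  parentⁿ-suc (suc k) Y = cong parent (parentⁿ-suc k Y)

  ∣parentⁿ∣ : ∀ k Y → ∣ parentⁿ k Y ∣ ≡ ∣ Y ∣ ∸ k
  ∣parentⁿ∣ zero Y = refl
  ∣parentⁿ∣ (suc k) Y = begin
    ∣ parent (parentⁿ k Y) ∣ ≡⟨ ∣parent∣ (parentⁿ k Y) ⟩
    ∣ parentⁿ k Y ∣ ∸ 1      ≡⟨ cong (_∸ 1) (∣parentⁿ∣ k Y) ⟩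
    ∣ Y ∣ ∸ k ∸ 1            ≡⟨ ∸-+-assoc ∣ Y ∣ k 1 ⟩
    ∣ Y ∣ ∸ (k + 1)          ≡⟨ cong (∣ Y ∣ ∸_) (+-comm k 1) ⟩
    ∣ Y ∣ ∸ suc k            ∎
    where open ≡-Reasoning

  Ancestor : Subset n → Subset n → Set
  Ancestor A V = ∃ λ k → parentⁿ k V ≡ A

  ancestor-unique : ∀ {A B V} → Ancestor A V → Ancestor B V → ∣ A ∣ ≡ ∣ B ∣ → A ≢ ∅ → A ≡ B
  ancestor-unique {V = V} (k , refl) (m , refl) ∣A∣≡∣B∣ A≢∅ =
    cong (λ j → parentⁿ j V) (∸-cancelˡ-≡ (below k ∣V∣∸k>0) (below m (subst (1 ≤_) same ∣V∣∸k>0)) same)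
    where
    same : ∣ V ∣ ∸ k ≡ ∣ V ∣ ∸ m
    same = trans (sym (∣parentⁿ∣ k V)) (trans ∣A∣≡∣B∣ (∣parentⁿ∣ m V))
    ∣V∣∸k>0 : 1 ≤ ∣ V ∣ ∸ k
    ∣V∣∸k>0 = subst (1 ≤_) (∣parentⁿ∣ k V) (S≢∅⇒∣S∣>0 _ A≢∅)
    below : ∀ j → 1 ≤ ∣ V ∣ ∸ j → j ≤ ∣ V ∣
    below j pos = <⇒≤ (m∸n≢0⇒n<m (m<n⇒n≢0 pos))

  ¬Ancestor-parent : ∀ U → U ≢ ∅ → ¬ Ancestor U (parent U)
  ¬Ancestor-parent U U≢∅ (k , eq) = 1+n≰n (begin
    suc ∣ parent U ∣            ≡⟨ ∣child∣ refl U≢∅ ⟨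
    ∣ U ∣                       ≡⟨ cong ∣_∣ eq ⟨
    ∣ parentⁿ k (parent U) ∣    ≡⟨ ∣parentⁿ∣ k (parent U) ⟩
    ∣ parent U ∣ ∸ k            ≤⟨ m∸n≤m _ k ⟩
    ∣ parent U ∣                ∎)
    where open ≤-Reasoning

  walk-below : ∀ {P B V bs} → IsWalk tree B V bs → Unique (P ∷ bs) → P ≡ parent B → Ancestor B V
  walk-below here _ _ = 0 , refl
  walk-below (step a w) (P∉ ∷ u) P≡ with Adj⇒parent a
  ... | inj₁ (B′≡ , _) with walk-head w
  ...   | _ , refl = ⊥-elim (All.lookup P∉ (there (here refl)) (trans P≡ (sym B′≡)))
  walk-below (step a w) (P∉ ∷ u) P≡ | inj₂ (B≡ , _) with walk-below w u B≡
  ... | k , eq = suc k , trans (cong parent eq) (sym B≡)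

  walk-enters : ∀ {U W V ws} → IsWalk tree W V ws → ¬ Ancestor U W → Ancestor U V → U ∈ₗ ws
  walk-enters here ¬anc anc = ⊥-elim (¬anc anc)
  walk-enters {U} (step {W = W′} a w) ¬anc anc with W′ ≟ˢ U
  ... | yes refl with walk-head w
  ...   | _ , refl = there (here refl)
  walk-enters {U} {W} (step {W = W′} a w) ¬anc anc | no W′≢U = there (walk-enters w ¬anc′ anc)
    where
    ¬anc′ : ¬ Ancestor U W′
    ¬anc′ (zero , eq) = W′≢U eq
    ¬anc′ (suc k , eq) with Adj⇒parent a
    ... | inj₁ (W′≡ , _) = ¬anc (suc (suc k) , trans (parentⁿ-suc (suc k) W) (trans (cong (parentⁿ (suc k)) (sym W′≡)) eq))
    ... | inj₂ (W≡ , _) = ¬anc (k , trans (cong (parentⁿ k) W≡) (trans (sym (parentⁿ-suc k W′)) eq))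

  -- Compare the first steps: two steps up coincide; two steps down reach children of U that are
  -- both ancestors of V, hence equal; after a step down V lies below U, so a path starting
  -- upwards would have to come back through U.
  path-unique : ∀ {U V vs ws} → IsPath tree U V vs → IsPath tree U V ws → vs ≡ ws
  path-unique (here , _) (here , _) = refl
  path-unique (here , _) (step a w , U∉ ∷ _) = ⊥-elim (All.lookup U∉ (walk-last w) refl)
  path-unique (step a w , U∉ ∷ _) (here , _) = ⊥-elim (All.lookup U∉ (walk-last w) refl)
  path-unique {U} (step {W = U₁} a₁ w₁ , U∉₁ ∷ u₁) (step {W = W₁} a₂ w₂ , U∉₂ ∷ u₂) with U₁ ≟ˢ W₁
  ... | yes refl = cong (U ∷_) (path-unique (w₁ , u₁) (w₂ , u₂))
  ... | no U₁≢W₁ = ⊥-elim (split (Adj⇒parent a₁) (Adj⇒parent a₂))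
    where
    split : (U₁ ≡ parent U × U ≢ ∅) ⊎ (U ≡ parent U₁ × U₁ ≢ ∅) → (W₁ ≡ parent U × U ≢ ∅) ⊎ (U ≡ parent W₁ × W₁ ≢ ∅) → ⊥
    split (inj₁ (e₁ , _)) (inj₁ (e₂ , _)) = U₁≢W₁ (trans e₁ (sym e₂))
    split (inj₂ (e₁ , n₁)) (inj₂ (e₂ , n₂)) = U₁≢W₁ (ancestor-unique (walk-below w₁ (U∉₁ ∷ u₁) e₁) (walk-below w₂ (U∉₂ ∷ u₂) e₂)
      (trans (∣child∣ e₁ n₁) (sym (∣child∣ e₂ n₂))) n₁)
    split (inj₂ (e₁ , _)) (inj₁ (e₂ , U≢∅)) with walk-below w₁ (U∉₁ ∷ u₁) e₁
    ... | k , eq = All.lookup U∉₂ (walk-enters w₂ (λ anc → ¬Ancestor-parent U U≢∅ (subst (Ancestor U) e₂ anc))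
                                               (suc k , trans (cong parent eq) (sym e₁))) refl
    split (inj₁ (e₁ , U≢∅)) (inj₂ (e₂ , _)) with walk-below w₂ (U∉₂ ∷ u₂) e₂
    ... | k , eq = All.lookup U∉₁ (walk-enters w₁ (λ anc → ¬Ancestor-parent U U≢∅ (subst (Ancestor U) e₁ anc))
                                               (suc k , trans (cong parent eq) (sym e₂))) refl

  pathToRoot : ∀ k U → ∣ U ∣ ≡ k → ∃ λ vs → IsPath tree U ∅ vs × length vs ≡ suc k × All (λ Z → ∣ Z ∣ ≤ k) vs
  pathToRoot zero U ∣U∣≡0 with ∣S∣≡0⇒S≡∅ U ∣U∣≡0
  ... | refl = _ , (here , [] ∷ []) , refl , (≤-reflexive ∣U∣≡0 ∷ [])
  pathToRoot (suc k) U ∣U∣≡ with pathToRoot k (parent U) (trans (∣parent∣ U) (cong (_∸ 1) ∣U∣≡))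
  ... | vs , (w , u) , len , small = U ∷ vs , (step (Adj-parent U U≢∅) w , All.map (smaller⇒≢ ∣U∣≡) small ∷ u) ,
        cong suc len , (≤-reflexive ∣U∣≡ ∷ All.map m≤n⇒m≤1+n small)
    where
    U≢∅ : U ≢ ∅
    U≢∅ refl = 0≢1+n (trans (sym (∣⊥∣≡0 n)) ∣U∣≡)
    smaller⇒≢ : ∀ {Z} → ∣ U ∣ ≡ suc k → ∣ Z ∣ ≤ k → U ≢ Z
    smaller⇒≢ ∣U∣≡ le refl = 1+n≰n (subst (_≤ k) ∣U∣≡ le)

  tree-connected : ∀ U V → ∃ (IsPath tree U V)
  tree-connected U V with pathToRoot _ U refl | pathToRoot _ V refl
  ... | _ , (wU , _) , _ | _ , (wV , _) , _ = walk⇒path (proj₂ (walk-++ wU (proj₂ (walk-reverse wV))))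

  tree-isSpanningTree : IsSpanningTree tree
  tree-isSpanningTree = tree-wellFormed , tree-connected , λ U V vs ws → path-unique

  tree-isUpright : IsUpright tree
  tree-isUpright X vs p with pathToRoot _ X refl
  ... | _ , q , len , _ = trans (cong length (path-unique p q)) len

  tree-psi : ∀ X → X ≢ ∅ → PsiIs tree X (ψ X)
  tree-psi X X≢∅ with pathToRoot _ (parent X) refl
  ... | vs , (w , u) , _ , small with walk-head w
  ...   | rest , refl = rest , step (Adj-parent X X≢∅) w , All.map ≢X small ∷ u
    where
    ≢X : ∀ {Z} → ∣ Z ∣ ≤ ∣ parent X ∣ → X ≢ Z
    ≢X le refl = 1+n≰n (subst (_≤ ∣ parent X ∣) (∣child∣ refl X≢∅) le)

  lookup-toggle-tree : ∀ i X → (if tree (toggle i X) i ∧ not (lookup (toggle i X) i) then 1 else 0) ≡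
                       iverson (lookup X i ∧ eqFin (ψ X) i)
  lookup-toggle-tree i X with lookup X i in e
  ... | true rewrite lookup-toggle-self X i | e | toggle-∪⁅⁆ X i e with eqFin (ψ X) i
  ...   | true = refl
  ...   | false = refl
  lookup-toggle-tree i X | false rewrite lookup-toggle-self X i | e = refl

  sig-tree : ∀ i → sig tree i ≡ sum (map (λ X → iverson (eqFin (ψ X) i)) (nonemptySubsets n))
  sig-tree i = begin
      sig tree i
        ≡⟨ sum-allSubsets n _ ⟩
      ΣS (λ X → if tree X i ∧ not (lookup X i) then 1 else 0)
        ≡⟨ ΣS-toggle i _ ⟩
      ΣS (λ X → if tree (toggle i X) i ∧ not (lookup (toggle i X) i) then 1 else 0)
        ≡⟨ ΣS-cong (lookup-toggle-tree i) ⟩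
      ΣS (λ X → iverson (lookup X i ∧ eqFin (ψ X) i))
        ≡⟨ sum-nonemptySubsets n _ ⟨
      sum (map (λ X → iverson (lookup X i ∧ eqFin (ψ X) i)) (nonemptySubsets n)) + iverson (lookup ∅ i ∧ eqFin (ψ ∅) i)
        ≡⟨ cong (λ b → sum (map (λ X → iverson (lookup X i ∧ eqFin (ψ X) i)) (nonemptySubsets n)) + iverson (b ∧ eqFin (ψ ∅) i)) (lookup-∅ i) ⟩
      sum (map (λ X → iverson (lookup X i ∧ eqFin (ψ X) i)) (nonemptySubsets n)) + 0
        ≡⟨ +-identityʳ _ ⟩
      sum (map (λ X → iverson (lookup X i ∧ eqFin (ψ X) i)) (nonemptySubsets n))
        ≡⟨ sum-cong-∈ (nonemptySubsets n) (λ Y Y∈ → drop-lookup Y (nonemptySubsets-≢∅ n Y Y∈)) ⟩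
      sum (map (λ X → iverson (eqFin (ψ X) i)) (nonemptySubsets n)) ∎
    where
    open ≡-Reasoning
    drop-lookup : ∀ Y → Y ≢ ∅ → iverson (lookup Y i ∧ eqFin (ψ Y) i) ≡ iverson (eqFin (ψ Y) i)
    drop-lookup Y Y≢∅ with eqFin (ψ Y) i in e
    ... | true rewrite sym (eqFin-sound (ψ Y) i e) | ψ∈ Y Y≢∅ = refl
    ... | false rewrite ∧-zeroʳ (lookup Y i) = refl

module SpanningTreeCounts {n : ℕ} (T : EdgeSet n) (spanning : IsSpanningTree T) where
  open Walks T

  path-unique : ∀ {U V vs ws} → IsPath T U V vs → IsPath T U V ws → vs ≡ ws
  path-unique {U} {V} = proj₂ (proj₂ spanning) U V _ _

  rootPath : Subset n → List (Subset n)
  rootPath V = proj₁ (proj₁ (proj₂ spanning) V ∅)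

  rootPath-isPath : ∀ V → IsPath T V ∅ (rootPath V)
  rootPath-isPath V = proj₂ (proj₁ (proj₂ spanning) V ∅)

  second : Subset n → List (Subset n) → Subset n
  second V (_ ∷ W ∷ _) = W
  second V _ = V

  -- The neighbour of V on its path to the root ∅ (and ∅ itself for V = ∅).
  next : Subset n → Subset n
  next V = second V (rootPath V)

  next-of-path : ∀ {V W rest} → IsPath T V ∅ (V ∷ W ∷ rest) → next V ≡ W
  next-of-path {V} p = cong (second V) (path-unique (rootPath-isPath V) p)

  next-∅ : next ∅ ≡ ∅
  next-∅ = cong (second ∅) (path-unique (rootPath-isPath ∅) (here , ([] ∷ [])))

  next-step : ∀ V → V ≢ ∅ → ∃ λ rest → IsPath T V ∅ (V ∷ next V ∷ rest) × Adj T V (next V)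
  next-step V V≢∅ with rootPath V | rootPath-isPath V
  ... | _ | here , _ = ⊥-elim (V≢∅ refl)
  ... | _ | step a w , u with walk-head w
  ...   | rest , refl = rest , (step a w , u) , a

  Adj-next : ∀ V → next V ≢ V → Adj T V (next V)
  Adj-next V next≢ with V ≟ˢ ∅
  ... | yes refl = ⊥-elim (next≢ next-∅)
  ... | no V≢∅ = proj₂ (proj₂ (next-step V V≢∅))

  Adj⇒toggle : ∀ {V W} → Adj T V W → ∃ λ d → W ≡ toggle d V
  Adj⇒toggle {V} (j , inj₁ (j∉V , refl , _)) = j , sym (toggle≡∪⁅⁆ V j (∉⇒lookup-false j∉V))
  Adj⇒toggle {W = W} (j , inj₂ (j∉W , refl , _)) =
    j , trans (sym (toggle-toggle W j)) (cong (toggle j) (toggle≡∪⁅⁆ W j (∉⇒lookup-false j∉W)))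

  Adj⇒≢ : ∀ {V W} → Adj T V W → V ≢ W
  Adj⇒≢ {V} a V≡W with Adj⇒toggle a
  ... | d , W≡ = true≢false (trans (sym (eqSubset-refl V)) (trans (cong (eqSubset V) (trans V≡W W≡)) (eqSubset-self-toggle V d)))

  Adj⇒next-of-neighbour : ∀ {V W ps} → Adj T V W → IsPath T W ∅ ps → V ∈ₗ ps → next W ≡ V
  Adj⇒next-of-neighbour a (here , _) (here V≡W) = ⊥-elim (Adj⇒≢ a V≡W)
  Adj⇒next-of-neighbour a (step _ _ , _) (here V≡W) = ⊥-elim (Adj⇒≢ a V≡W)
  Adj⇒next-of-neighbour a (step b w , W∉ ∷ u) (there V∈) with path-suffix w u V∈
  ... | qs , (q , uq) , qs⊆ with walk-head q
  ...   | _ , refl = next-of-path (step (Adj-sym a) q , All.tabulate (λ Z∈ W≡Z → All.lookup W∉ (qs⊆ Z∈) W≡Z) ∷ uq)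

  Adj⇒next : ∀ {V W} → Adj T V W → next V ≡ W ⊎ next W ≡ V
  Adj⇒next {V} {W} a with ∈⊎All≢ V (rootPath W)
  ... | inj₁ V∈ = inj₂ (Adj⇒next-of-neighbour a (rootPath-isPath W) V∈)
  ... | inj₂ V∉ with rootPath-isPath W
  ...   | w , u with walk-head w
  ...     | _ , eq = inj₁ (next-of-path (subst (λ ps → IsPath T V ∅ (V ∷ ps)) eq (step a w , V∉ ∷ u)))

  next-not-mutual : ∀ {V W} → V ≢ W → next V ≡ W → next W ≡ V → ⊥
  next-not-mutual {V} {W} V≢W eV eW with V ≟ˢ ∅
  ... | yes refl = V≢W (trans (sym next-∅) eV)
  ... | no V≢∅ with next-step V V≢∅
  ...   | rest , p , _ with subst (λ Z → IsPath T V ∅ (V ∷ Z ∷ rest)) eV p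
  ...     | step _ w , V∉ ∷ u with walk-head w
  ...       | _ , refl = All.lookup V∉ (second∈ rest) (trans (sym eW) (cong (second W) (path-unique (rootPath-isPath W) (w , u))))
    where
    second∈ : ∀ rest → second W (W ∷ rest) ∈ₗ W ∷ rest
    second∈ [] = here refl
    second∈ (_ ∷ _) = there (here refl)

  leaves : Subset n → Fin n → ℕ
  leaves X i = iverson (eqSubset (next X) (toggle i X))

  Adj⇒edge : ∀ X i → lookup X i ≡ false → Adj T X (toggle i X) → T X i ≡ true
  Adj⇒edge X i X∌i (j , inj₁ (_ , Y≡ , e)) = subst (λ k → T X k ≡ true) (sym (eqFin-sound i j i≡j)) e
    where
    i≡j : eqFin i j ≡ true
    i≡j = begin
      eqFin i j                       ≡⟨ lookup-⁅⁆ i j ⟨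
      lookup ⁅ j ⁆ i                  ≡⟨ cong (_∨ lookup ⁅ j ⁆ i) X∌i ⟨
      lookup X i ∨ lookup ⁅ j ⁆ i     ≡⟨ lookup-∪ X ⁅ j ⁆ i ⟨
      lookup (X ∪ ⁅ j ⁆) i            ≡⟨ cong (λ Z → lookup Z i) Y≡ ⟨
      lookup (toggle i X) i           ≡⟨ lookup-toggle-self X i ⟩
      not (lookup X i)                ≡⟨ cong not X∌i ⟩
      true                            ∎
      where open ≡-Reasoning
  Adj⇒edge X i X∌i (j , inj₂ (_ , X≡ , _)) = ⊥-elim (true≢false (trans (sym X∋i) X∌i))
    where
    X∋i : lookup X i ≡ true
    X∋i = begin
      lookup X i                                 ≡⟨ cong (λ Z → lookup Z i) X≡ ⟩
      lookup (toggle i X ∪ ⁅ j ⁆) i              ≡⟨ lookup-∪ (toggle i X) ⁅ j ⁆ i ⟩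
      lookup (toggle i X) i ∨ lookup ⁅ j ⁆ i     ≡⟨ cong (_∨ lookup ⁅ j ⁆ i) (trans (lookup-toggle-self X i) (cong not X∌i)) ⟩
      true                                       ∎
      where open ≡-Reasoning

  edge-indicator : ∀ X i → lookup X i ≡ false → iverson (T X i) ≡ leaves X i + leaves (toggle i X) i
  edge-indicator X i X∌i rewrite toggle-toggle X i
    with T X i in eT | eqSubset (next X) (toggle i X) in e₁ | eqSubset (next (toggle i X)) X in e₂
  ... | true | true | true =
    ⊥-elim (next-not-mutual (Adj⇒≢ (i , inj₁ (X∉ , toggle≡∪⁅⁆ X i X∌i , eT))) (eqSubset-sound _ _ e₁) (eqSubset-sound _ _ e₂))
    where X∉ = lookup-false⇒∉ X∌i
  ... | true | true | false = refl
  ... | true | false | true = refl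
  ... | true | false | false with Adj⇒next {X} {toggle i X} (i , inj₁ (lookup-false⇒∉ X∌i , toggle≡∪⁅⁆ X i X∌i , eT))
  ...   | inj₁ eq = ⊥-elim (true≢false (trans (sym (trans (cong (λ Z → eqSubset Z (toggle i X)) eq) (eqSubset-refl (toggle i X)))) e₁))
  ...   | inj₂ eq = ⊥-elim (true≢false (trans (sym (trans (cong (λ Z → eqSubset Z X) eq) (eqSubset-refl X))) e₂))
  edge-indicator X i X∌i | false | true | _ =
    ⊥-elim (true≢false (trans (sym (Adj⇒edge X i X∌i (subst (Adj T X) next≡ (Adj-next X next≢)))) eT))
    where
    next≡ : next X ≡ toggle i X
    next≡ = eqSubset-sound _ _ e₁
    next≢ : next X ≢ X
    next≢ eq = true≢false (trans (sym e₁) (trans (cong (λ Z → eqSubset Z (toggle i X)) eq) (eqSubset-self-toggle X i)))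
  edge-indicator X i X∌i | false | false | true =
    ⊥-elim (true≢false (trans (sym (Adj⇒edge X i X∌i (Adj-sym (subst (Adj T (toggle i X)) next≡ (Adj-next (toggle i X) next≢))))) eT))
    where
    next≡ : next (toggle i X) ≡ X
    next≡ = eqSubset-sound _ _ e₂
    next≢ : next (toggle i X) ≢ toggle i X
    next≢ eq = true≢false (trans (sym (eqSubset-refl X)) (trans (cong (eqSubset X) (trans (sym next≡) eq)) (eqSubset-self-toggle X i)))
  edge-indicator X i X∌i | false | false | false = refl

  sig≡ΣS-leaves : ∀ i → sig T i ≡ ΣS (λ X → leaves X i)
  sig≡ΣS-leaves i = begin
      sig T i
        ≡⟨ sum-allSubsets n _ ⟩
      ΣS (λ X → if T X i ∧ not (lookup X i) then 1 else 0)
        ≡⟨ ΣS-cong (λ X → trans (iverson-if _) (split X)) ⟩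
      ΣS (λ X → lower X + upper X)
        ≡⟨ ΣS-+ lower upper ⟩
      ΣS lower + ΣS upper
        ≡⟨ cong (ΣS lower +_) (ΣS-toggle i upper) ⟩
      ΣS lower + ΣS (λ X → upper (toggle i X))
        ≡⟨ ΣS-+ lower (λ X → upper (toggle i X)) ⟨
      ΣS (λ X → lower X + upper (toggle i X))
        ≡⟨ ΣS-cong recombine ⟩
      ΣS (λ X → leaves X i) ∎
    where
    open ≡-Reasoning
    lower upper : Subset n → ℕ
    lower X = if lookup X i then 0 else leaves X i
    upper X = if lookup X i then 0 else leaves (toggle i X) i
    split : ∀ X → iverson (T X i ∧ not (lookup X i)) ≡ lower X + upper X
    split X with lookup X i in X∋i
    ... | true = cong iverson (∧-zeroʳ (T X i))
    ... | false = trans (cong iverson (∧-identityʳ (T X i))) (edge-indicator X i X∋i)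
    recombine : ∀ X → lower X + upper (toggle i X) ≡ leaves X i
    recombine X rewrite lookup-toggle-self X i | toggle-toggle X i with lookup X i
    ... | true = refl
    ... | false = +-identityʳ _

  sumOver-leaves : ∀ S V d → next V ≡ toggle d V → sumOver S (leaves V) ≡ iverson (lookup S d)
  sumOver-leaves S V d next≡ = begin
    sumOver S (leaves V)                                    ≡⟨ sumOver-cong S pointwise ⟩
    sumOver S (λ i → if eqFin i d then 1 else 0)            ≡⟨ sumOver-δ S d 1 ⟩
    (if lookup S d then 1 else 0)                           ≡⟨ iverson-if (lookup S d) ⟩
    iverson (lookup S d)                                    ∎
    where
    open ≡-Reasoning
    pointwise : ∀ i → leaves V i ≡ (if eqFin i d then 1 else 0)
    pointwise i rewrite next≡ | eqSubset-toggle V d i | eqFin-sym d i = sym (iverson-if (eqFin i d))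

  sumOver-leaves-∅ : ∀ S → sumOver S (leaves ∅) ≡ 0
  sumOver-leaves-∅ S = trans (sumOver-cong S none) (sumOver-0 S)
    where
    none : ∀ i → leaves ∅ i ≡ 0
    none i rewrite next-∅ | eqSubset-self-toggle (∅ {n}) i = refl

  sumOver-sig : ∀ S → sumOver S (sig T) ≡ ΣS (λ X → sumOver S (leaves X))
  sumOver-sig S = trans (sumOver-cong S sig≡ΣS-leaves) (sumOver-swap S leaves)

  sumOver-sig-full : sumOver full (sig T) ≡ length (nonemptySubsets n)
  sumOver-sig-full = begin
      sumOver full (sig T)
        ≡⟨ sumOver-sig full ⟩
      ΣS (λ X → sumOver full (leaves X))
        ≡⟨ sum-nonemptySubsets n _ ⟨
      sum (map (λ X → sumOver full (leaves X)) (nonemptySubsets n)) + sumOver full (leaves ∅)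
        ≡⟨ cong₂ _+_ (sum-cong-∈ (nonemptySubsets n) one) (sumOver-leaves-∅ full) ⟩
      sum (map (λ _ → 1) (nonemptySubsets n)) + 0
        ≡⟨ trans (+-identityʳ _) (sym (length≡sum-map-1 (nonemptySubsets n))) ⟩
      length (nonemptySubsets n) ∎
    where
    open ≡-Reasoning
    one : ∀ X → X ∈ₗ nonemptySubsets n → sumOver full (leaves X) ≡ 1
    one X X∈ with Adj⇒toggle (proj₂ (proj₂ (next-step X (nonemptySubsets-≢∅ n X X∈))))
    ... | d , next≡ = trans (sumOver-leaves full X d next≡) (cong iverson (lookup-full d))

  -- Following the root path from a vertex with trace P on S, the trace must eventually change
  -- (it ends at ∅); the vertex where it first does leaves in a direction of S.
  exit-vertex : ∀ S {P V vs} → IsPath T V ∅ vs → V ∩ S ≡ P → P ≢ ∅ → ∃ λ X → X ∩ S ≡ P × 1 ≤ sumOver S (leaves X)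
  exit-vertex S (here , _) V∩S≡P P≢∅ = ⊥-elim (P≢∅ (trans (sym V∩S≡P) (∩-zeroˡ S)))
  exit-vertex S {P} {V} (step {W = W} a w , V∉ ∷ u) V∩S≡P P≢∅ with W ∩ S ≟ˢ P
  ... | yes W∩S≡P = exit-vertex S (w , u) W∩S≡P P≢∅
  ... | no W∩S≢P with Adj⇒toggle a
  ...   | d , W≡ with lookup S d in S∋d
  ...     | true = V , V∩S≡P , ≤-reflexive (sym (trans (sumOver-leaves S V d (trans (next-of-path p) W≡)) (cong iverson S∋d)))
    where
    p : IsPath T V ∅ (V ∷ W ∷ proj₁ (walk-head w))
    p = subst (λ ws → IsPath T V ∅ (V ∷ ws)) (proj₂ (walk-head w)) (step a w , V∉ ∷ u)
  ...     | false = ⊥-elim (W∩S≢P (trans (cong (_∩ S) W≡) (trans (toggle-∩ V S d S∋d) V∩S≡P)))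

  -- Every nonempty P ⊆ S has its own exit vertex X (with X ∩ S = P), so the edges leaving
  -- in directions of S number at least 2^|S| − 1.
  sumOver-sig-lower : ∀ S → 2 ^ ∣ S ∣ ≤ sumOver S (sig T) + 1
  sumOver-sig-lower S = begin
      2 ^ ∣ S ∣
        ≡⟨ ΣS-nonempty-⊆ S ⟨
      ΣS (λ P → iverson (eqSubset (P ∩ S) P ∧ not (eqSubset ∅ P))) + 1
        ≤⟨ +-monoˡ-≤ 1 (ΣS-mono exits) ⟩
      ΣS (λ P → ΣS (λ X → iverson (eqSubset (X ∩ S) P) * h X)) + 1
        ≡⟨ cong (_+ 1) (ΣS-fibres (_∩ S) h) ⟨
      ΣS h + 1
        ≡⟨ cong (_+ 1) (sumOver-sig S) ⟨
      sumOver S (sig T) + 1 ∎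
    where
    open ≤-Reasoning
    h : Subset n → ℕ
    h X = sumOver S (leaves X)
    exits : ∀ P → iverson (eqSubset (P ∩ S) P ∧ not (eqSubset ∅ P)) ≤ ΣS (λ X → iverson (eqSubset (X ∩ S) P) * h X)
    exits P with eqSubset (P ∩ S) P in P⊆S | eqSubset ∅ P in P≡∅
    ... | false | _ = z≤n
    ... | true | true = z≤n
    ... | true | false with exit-vertex S (rootPath-isPath P) (eqSubset-sound _ _ P⊆S) (λ P≡ → true≢false (trans (sym (eqSubset-refl (∅ {n}))) (trans (cong (eqSubset ∅) (sym P≡)) P≡∅)))
    ...   | X , X∩S≡P , hX>0 = begin
      1                                                    ≤⟨ hX>0 ⟩
      h X                                                  ≡⟨ *-identityˡ (h X) ⟨
      1 * h X                                              ≡⟨ cong (λ b → iverson b * h X) (eqSubset-refl P) ⟨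
      iverson (eqSubset P P) * h X                         ≡⟨ cong (λ Z → iverson (eqSubset Z P) * h X) X∩S≡P ⟨
      iverson (eqSubset (X ∩ S) P) * h X                   ≤⟨ ΣS-point (λ Y → iverson (eqSubset (Y ∩ S) P) * h Y) X ⟩
      ΣS (λ Y → iverson (eqSubset (Y ∩ S) P) * h Y)        ∎

sumOver-∪⁅⁆ : ∀ {n} (S : Subset n) y (a : Fin n → ℕ) → lookup S y ≡ false → sumOver (S ∪ ⁅ y ⁆) a ≡ sumOver S a + a y
sumOver-∪⁅⁆ (false ∷ S) zero a e = trans (cong (λ Z → a zero + sumOver Z (λ i → a (suc i))) (∪-identityʳ S)) (+-comm (a zero) _)
sumOver-∪⁅⁆ (true ∷ S) (suc y) a e = trans (cong (a zero +_) (sumOver-∪⁅⁆ S y (λ i → a (suc i)) e)) (sym (+-assoc (a zero) _ _))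
sumOver-∪⁅⁆ (false ∷ S) (suc y) a e = sumOver-∪⁅⁆ S y (λ i → a (suc i)) e

sumOver-─⁅⁆ : ∀ {n} (S : Subset n) x (a : Fin n → ℕ) → lookup S x ≡ true → sumOver S a ≡ sumOver (S ─ ⁅ x ⁆) a + a x
sumOver-─⁅⁆ S x a S∋x = trans (cong (λ Z → sumOver Z a) (sym (─⁅⁆∪⁅⁆ S x S∋x))) (sumOver-∪⁅⁆ (S ─ ⁅ x ⁆) x a (lookup-─-self S x))

sumOver-const : ∀ {n} (S : Subset n) m → sumOver S (λ _ → m) ≡ ∣ S ∣ * m
sumOver-const [] m = refl
sumOver-const (true ∷ S) m = cong (m +_) (sumOver-const S m)
sumOver-const (false ∷ S) m = sumOver-const S m

2^suc : ∀ m → 2 ^ suc m ≡ 2 ^ m + 2 ^ m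
2^suc m = cong (2 ^ m +_) (+-identityʳ (2 ^ m))

m<n≤1⇒m≡0×n≡1 : ∀ {m k} → m < k → k ≤ 1 → m ≡ 0 × k ≡ 1
m<n≤1⇒m≡0×n≡1 (s≤s z≤n) (s≤s z≤n) = refl , refl

-- A set S of directions is critical if Σ_{i∈S} aᵢ = 2^|S|, one more than the lower bound.
module CriticalSets {n : ℕ} (a : Fin n → ℕ) (ordered : IsOrdered a) (a≥2 : (i : Fin n) → 2 ≤ a i)
                 (lower : (S : Subset n) → 2 ^ ∣ S ∣ ≤ sumOver S a + 1)
                 (not-all≤2 : ¬ ((i : Fin n) → toℕ i ≤ 2 → a i ≤ 2)) where

  -- Adding y to S gives 2^|S| ≤ a y + 1 ≤ a x + 1; with aᵢ ≥ 2 on S − {x} this forces S = {x}.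
  critical⇒a≡2 : ∀ S {x y} → lookup S x ≡ true → lookup S y ≡ false → toℕ y ≤ toℕ x →
              sumOver S a ≡ 2 ^ ∣ S ∣ → a x ≡ 2
  critical⇒a≡2 S {x} {y} S∋x S∌y y≤x critical = ≤-antisym ax≤2 (a≥2 x)
    where
    open ≤-Reasoning
    S′ = S ─ ⁅ x ⁆
    k = ∣ S′ ∣
    p = 2 ^ ∣ S ∣
    split : sumOver S a ≡ sumOver S′ a + a x
    split = sumOver-─⁅⁆ S x a S∋x
    grow : p ≤ a y + 1
    grow = +-cancelˡ-≤ p _ _ (begin
      p + p                        ≡⟨ 2^suc ∣ S ∣ ⟨
      2 ^ suc ∣ S ∣                ≡⟨ cong (2 ^_) (∣∪⁅⁆∣ S y S∌y) ⟨
      2 ^ ∣ S ∪ ⁅ y ⁆ ∣            ≤⟨ lower (S ∪ ⁅ y ⁆) ⟩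
      sumOver (S ∪ ⁅ y ⁆) a + 1    ≡⟨ cong (_+ 1) (trans (sumOver-∪⁅⁆ S y a S∌y) (cong (_+ a y) critical)) ⟩
      p + a y + 1                  ≡⟨ +-assoc p (a y) 1 ⟩
      p + (a y + 1)                ∎)
    k*2≤1 : k * 2 ≤ 1
    k*2≤1 = +-cancelʳ-≤ p _ _ (begin
      k * 2 + p                    ≤⟨ +-monoʳ-≤ (k * 2) (≤-trans grow (+-monoˡ-≤ 1 (ordered y x y≤x))) ⟩
      k * 2 + (a x + 1)            ≡⟨ +-assoc (k * 2) (a x) 1 ⟨
      k * 2 + a x + 1              ≡⟨ cong (λ m → m + a x + 1) (sumOver-const S′ 2) ⟨
      sumOver S′ (λ _ → 2) + a x + 1 ≤⟨ +-monoˡ-≤ 1 (+-monoˡ-≤ (a x) (sumOver-mono S′ a≥2)) ⟩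
      sumOver S′ a + a x + 1       ≡⟨ cong (_+ 1) (trans (sym split) critical) ⟩
      p + 1                        ≡⟨ +-comm p 1 ⟩
      1 + p                        ∎)
    ∣S∣≡1 : ∣ S ∣ ≡ 1
    ∣S∣≡1 with k in k≡ | k*2≤1
    ... | zero | _ = trans (sym (∣─⁅⁆∣ S x S∋x)) (cong suc k≡)
    ... | suc _ | s≤s ()
    ax≤2 : a x ≤ 2
    ax≤2 = begin
      a x                  ≤⟨ m≤n+m (a x) (sumOver S′ a) ⟩
      sumOver S′ a + a x   ≡⟨ trans (sym split) critical ⟩
      2 ^ ∣ S ∣            ≡⟨ cong (2 ^_) ∣S∣≡1 ⟩
      2                    ∎

  a≡2⇒≤1 : ∀ x → a x ≡ 2 → toℕ x ≤ 1
  a≡2⇒≤1 x ax≡2 with toℕ x ≤? 1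
  ... | yes x≤1 = x≤1
  ... | no x≰1 = ⊥-elim (not-all≤2 λ i i≤2 → subst (a i ≤_) ax≡2 (ordered i x (≤-trans i≤2 (≰⇒> x≰1))))

  -- Such an S is {x}, and y ∈ Xm − S lies below x; with a x = 2 and not all of a₁, a₂, a₃ ≤ 2
  -- (paper's numbering) this leaves only x = 2, y = 1, i.e. Xm = {1,2}.
  critical⇒exceptional : ∀ Xm Xo x → Xm ≢ Xo → IsMax Xm x → lookup Xo x ≡ true → ∀ S → lookup S x ≡ true →
                      isSubset Xm S ≡ false → isSubset Xo S ≡ false → sumOver S a ≡ 2 ^ ∣ S ∣ →
                      toℕ x ≡ 1 × ((i : Fin n) → toℕ i ≤ 1 → a i ≡ 2) × Is12 Xm × Not⊆12 Xo
  critical⇒exceptional Xm Xo x Xm≢Xo (x∈Xm , max) Xo∋x S S∋x Xm⊈S Xo⊈S critical with isSubset-false-witness Xm S Xm⊈S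
  ... | y , Xm∋y , S∌y = x≡1 , a≡2 , Xm≡12 , Xo⊈12
    where
    y≤x : toℕ y ≤ toℕ x
    y≤x = max y (lookup⇒[]= y Xm Xm∋y)
    ax≡2 : a x ≡ 2
    ax≡2 = critical⇒a≡2 S S∋x S∌y y≤x critical
    y≢x : y ≢ x
    y≢x refl = true≢false (trans (sym S∋x) S∌y)
    y≡0×x≡1 : toℕ y ≡ 0 × toℕ x ≡ 1
    y≡0×x≡1 = m<n≤1⇒m≡0×n≡1 (≤∧≢⇒< y≤x (λ eq → y≢x (toℕ-injective eq))) (a≡2⇒≤1 x ax≡2)
    x≡1 : toℕ x ≡ 1
    x≡1 = proj₂ y≡0×x≡1
    a≡2 : ∀ i → toℕ i ≤ 1 → a i ≡ 2
    a≡2 i i≤1 = ≤-antisym (subst (a i ≤_) ax≡2 (ordered i x (subst (toℕ i ≤_) (sym x≡1) i≤1))) (a≥2 i)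
    y-or-x : ∀ i → toℕ i ≤ 1 → i ≡ y ⊎ i ≡ x
    y-or-x i i≤1 with n≤1⇒n≡0∨n≡1 i≤1
    ... | inj₁ i≡0 = inj₁ (toℕ-injective (trans i≡0 (sym (proj₁ y≡0×x≡1))))
    ... | inj₂ i≡1 = inj₂ (toℕ-injective (trans i≡1 (sym x≡1)))
    Xm≡12 : Is12 Xm
    Xm≡12 i = (λ i∈Xm → subst (toℕ i ≤_) x≡1 (max i i∈Xm)) , λ i≤1 → [ (λ { refl → lookup⇒[]= y Xm Xm∋y }) , (λ { refl → x∈Xm }) ]′ (y-or-x i i≤1)
    Xo⊈12 : Not⊆12 Xo
    Xo⊈12 with any? (λ i → (i ∈? Xo) ×-dec (2 ≤? toℕ i))
    ... | yes witness = witness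
    ... | no none = ⊥-elim (Xm≢Xo (lookup-ext same))
      where
      Xo⊆12 : ∀ i → lookup Xo i ≡ true → toℕ i ≤ 1
      Xo⊆12 i Xo∋i with toℕ i ≤? 1
      ... | yes i≤1 = i≤1
      ... | no i≰1 = ⊥-elim (none (i , lookup⇒[]= i Xo Xo∋i , ≰⇒> i≰1))
      Xo∋y : lookup Xo y ≡ true
      Xo∋y with isSubset-false-witness Xo S Xo⊈S
      ... | z , Xo∋z , S∌z with y-or-x z (Xo⊆12 z Xo∋z)
      ...   | inj₁ refl = Xo∋z
      ...   | inj₂ refl = ⊥-elim (true≢false (trans (sym S∋x) S∌z))
      same : ∀ i → lookup Xm i ≡ lookup Xo i
      same i with lookup Xo i in Xo∋i
      ... | true = []=⇒lookup (proj₂ (Xm≡12 i) (Xo⊆12 i Xo∋i))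
      ... | false with lookup Xm i in Xm∋i
      ...   | false = refl
      ...   | true with y-or-x i (proj₁ (Xm≡12 i) (lookup⇒[]= i Xm Xm∋i))
      ...     | inj₁ refl = ⊥-elim (true≢false (trans (sym Xo∋y) Xo∋i))
      ...     | inj₂ refl = ⊥-elim (true≢false (trans (sym Xo∋x) Xo∋i))

  ¬Exceptional⇒no-critical : ∀ {X₁ X₂ x} → X₁ ≢ X₂ → x ∈ X₁ → x ∈ X₂ → IsMax X₁ x ⊎ IsMax X₂ x → ¬ Exceptional a X₁ X₂ x →
                          ∀ S → lookup S x ≡ true → isSubset X₁ S ≡ false → isSubset X₂ S ≡ false → sumOver S a ≢ 2 ^ ∣ S ∣
  ¬Exceptional⇒no-critical X₁≢X₂ x∈X₁ x∈X₂ (inj₁ max₁) ¬exc S S∋x X₁⊈S X₂⊈S critical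
    with critical⇒exceptional _ _ _ X₁≢X₂ max₁ ([]=⇒lookup x∈X₂) S S∋x X₁⊈S X₂⊈S critical
  ... | x≡1 , a≡2 , X₁≡12 , X₂⊈12 = ¬exc (x≡1 , a≡2 , inj₁ (X₁≡12 , X₂⊈12))
  ¬Exceptional⇒no-critical X₁≢X₂ x∈X₁ x∈X₂ (inj₂ max₂) ¬exc S S∋x X₁⊈S X₂⊈S critical
    with critical⇒exceptional _ _ _ (≢-sym X₁≢X₂) max₂ ([]=⇒lookup x∈X₁) S S∋x X₂⊈S X₁⊈S critical
  ... | x≡1 , a≡2 , X₂≡12 , X₁⊈12 = ¬exc (x≡1 , a≡2 , inj₂ (X₂≡12 , X₁⊈12))

signature-total : ∀ {n} {a : Fin n → ℕ} → IsSignature a → sumOver full a ≡ length (nonemptySubsets n)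
signature-total (T , spanning , sig≡a) =
  trans (sumOver-cong full (λ i → sym (sig≡a i))) (SpanningTreeCounts.sumOver-sig-full T spanning)

signature-lower : ∀ {n} {a : Fin n → ℕ} → IsSignature a → (S : Subset n) → 2 ^ ∣ S ∣ ≤ sumOver S a + 1
signature-lower (T , spanning , sig≡a) S =
  subst (λ m → 2 ^ ∣ S ∣ ≤ m + 1) (sumOver-cong S sig≡a) (SpanningTreeCounts.sumOver-sig-lower T spanning S)

irreducible-strict : ∀ {n} {a : Fin n → ℕ} → IsSignature a → IsIrreducible a →
                     (S : Subset n) → Nonempty S → (∃ λ j → j ∉ S) → 2 ^ ∣ S ∣ ≤ sumOver S a
irreducible-strict signature irreducible S S≢∅ proper with m≤n⇒m<n∨m≡n (signature-lower signature S)
... | inj₁ 2^∣S∣<Σ+1 = ≤-pred (subst (2 ^ ∣ S ∣ <_) (+-comm _ 1) 2^∣S∣<Σ+1)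
... | inj₂ 2^∣S∣≡Σ+1 = ⊥-elim (irreducible (S , S≢∅ , proper , sym (trans (cong (_∸ 1) 2^∣S∣≡Σ+1) (m+n∸n≡m _ 1))))

signature-≥2 : ∀ {m} {a : Fin (2 + m) → ℕ} → IsSignature a → IsOrdered a → IsIrreducible a → (i : Fin (2 + m)) → 2 ≤ a i
signature-≥2 {m} {a} signature ordered irreducible i = ≤-trans a₀≥2 (ordered zero i z≤n)
  where
  a₀≥2 : 2 ≤ a zero
  a₀≥2 = subst₂ (λ k s → 2 ^ k ≤ s) (∣⁅x⁆∣≡1 {n = 2 + m} zero) (sumOver-⁅⁆ zero a)
           (irreducible-strict signature irreducible ⁅ zero ⁆ (zero , x∈⁅x⁆ zero) (suc zero , x≢y⇒x∉⁅y⁆ {x = suc zero} {y = zero} (λ ())))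

-- The set {1,2,3} of directions needs Σ aᵢ ≥ 2³ − 1.
signature-not-all≤2 : ∀ {m} {a : Fin (3 + m) → ℕ} → IsSignature a → ¬ ((i : Fin (3 + m)) → toℕ i ≤ 2 → a i ≤ 2)
signature-not-all≤2 {m} {a} signature a≤2 = 1+n≰n (begin
    8                                          ≡⟨ cong (λ k → 2 ^ (3 + k)) (∣⊥∣≡0 m) ⟨
    2 ^ ∣ first3 ∣                             ≤⟨ signature-lower signature first3 ⟩
    sumOver first3 a + 1                       ≡⟨ cong (λ s → a zero + (a (suc zero) + (a (suc (suc zero)) + s)) + 1) (sumOver-∅ {m} _) ⟩
    a zero + (a (suc zero) + (a (suc (suc zero)) + 0)) + 1
      ≤⟨ +-monoˡ-≤ 1 (+-mono-≤ (a≤2 zero z≤n) (+-mono-≤ (a≤2 (suc zero) (s≤s z≤n)) (+-monoˡ-≤ 0 (a≤2 (suc (suc zero)) (s≤s (s≤s z≤n)))))) ⟩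
    7                                          ∎)
  where
  open ≤-Reasoning
  first3 : Subset (3 + m)
  first3 = true ∷ true ∷ true ∷ ∅

⊈⇒proper : ∀ {n} (X S : Subset n) → isSubset X S ≡ false → ∃ λ j → j ∉ S
⊈⇒proper X S X⊈S with isSubset-false-witness X S X⊈S
... | j , _ , S∌j = j , lookup-false⇒∉ S∌j

module Prescribed {n : ℕ} (X₁ X₂ : Subset n) (x : Fin n) where

  allowed : Subset n → Subset n
  allowed Y = if eqSubset Y X₁ ∨ eqSubset Y X₂ then ⁅ x ⁆ else Y

  open Hall _≟ˢ_ allowed public

  extra : Subset n → Subset n → ℕ
  extra X S = iverson (lookup S x ∧ not (isSubset X S))

  allowed-⊆ : ∀ S Y → iverson (isSubset (allowed Y) S) ≤
              iverson (isSubset Y S) + (iverson (eqSubset Y X₁) * extra X₁ S + iverson (eqSubset Y X₂) * extra X₂ S)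
  allowed-⊆ S Y with eqSubset Y X₁ in Y≡X₁ | eqSubset Y X₂ in Y≡X₂
  ... | true | _ with eqSubset-sound Y X₁ Y≡X₁
  ...   | refl rewrite isSubset-⁅⁆ x S with lookup S x | isSubset Y S
  ...     | true | true = s≤s z≤n
  ...     | true | false = s≤s z≤n
  ...     | false | _ = z≤n
  allowed-⊆ S Y | false | true with eqSubset-sound Y X₂ Y≡X₂
  ...   | refl rewrite isSubset-⁅⁆ x S with lookup S x | isSubset Y S
  ...     | true | true = s≤s z≤n
  ...     | true | false = s≤s z≤n
  ...     | false | _ = z≤n
  allowed-⊆ S Y | false | false = m≤m+n _ _

  subsetsOf : Subset n → ℕ
  subsetsOf S = sum (map (λ Y → iverson (isSubset Y S)) (nonemptySubsets n))

  demand-bound : ∀ S → demand (nonemptySubsets n) S ≤ subsetsOf S + (extra X₁ S + extra X₂ S)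
  demand-bound S = begin
      demand F S
        ≤⟨ sum-mono-∈ F (λ Y _ → allowed-⊆ S Y) ⟩
      sum (map (λ Y → iverson (isSubset Y S) + (δ₁ Y * extra X₁ S + δ₂ Y * extra X₂ S)) F)
        ≡⟨ sum-map-+ F _ _ ⟩
      subsetsOf S + sum (map (λ Y → δ₁ Y * extra X₁ S + δ₂ Y * extra X₂ S) F)
        ≡⟨ cong (subsetsOf S +_) (sum-map-+ F _ _) ⟩
      subsetsOf S + (sum (map (λ Y → δ₁ Y * extra X₁ S) F) + sum (map (λ Y → δ₂ Y * extra X₂ S) F))
        ≡⟨ cong (subsetsOf S +_) (cong₂ _+_ (sum-map-* F δ₁ (extra X₁ S)) (sum-map-* F δ₂ (extra X₂ S))) ⟩
      subsetsOf S + (sum (map δ₁ F) * extra X₁ S + sum (map δ₂ F) * extra X₂ S)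
        ≤⟨ +-monoʳ-≤ (subsetsOf S) (+-mono-≤ (at-most-once X₁ (extra X₁ S)) (at-most-once X₂ (extra X₂ S))) ⟩
      subsetsOf S + (extra X₁ S + extra X₂ S) ∎
    where
    open ≤-Reasoning
    F = nonemptySubsets n
    δ₁ δ₂ : Subset n → ℕ
    δ₁ Y = iverson (eqSubset Y X₁)
    δ₂ Y = iverson (eqSubset Y X₂)
    at-most-once : ∀ X e → sum (map (λ Y → iverson (eqSubset Y X)) F) * e ≤ e
    at-most-once X e = ≤-trans (*-monoˡ-≤ e (sum-eqSubset-unique F X (nonemptySubsets-unique n))) (≤-reflexive (+-identityʳ e))

  module _ (a : Fin n → ℕ) (lower : (S : Subset n) → 2 ^ ∣ S ∣ ≤ sumOver S a + 1)
           (lower-proper : (S : Subset n) → Nonempty S → (∃ λ j → j ∉ S) → 2 ^ ∣ S ∣ ≤ sumOver S a)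
           (no-critical : (S : Subset n) → lookup S x ≡ true → isSubset X₁ S ≡ false → isSubset X₂ S ≡ false →
                       sumOver S a ≢ 2 ^ ∣ S ∣) where

    extra-covered : ∀ S → 2 ^ ∣ S ∣ + (extra X₁ S + extra X₂ S) ≤ sumOver S a + 1
    extra-covered S with lookup S x in S∋x | isSubset X₁ S in X₁⊆S | isSubset X₂ S in X₂⊆S
    ... | false | _ | _ = subst (_≤ sumOver S a + 1) (sym (+-identityʳ _)) (lower S)
    ... | true | true | true = subst (_≤ sumOver S a + 1) (sym (+-identityʳ _)) (lower S)
    ... | true | false | true = +-monoˡ-≤ 1 (lower-proper S (x , lookup⇒[]= x S S∋x) (⊈⇒proper X₁ S X₁⊆S))
    ... | true | true | false = +-monoˡ-≤ 1 (lower-proper S (x , lookup⇒[]= x S S∋x) (⊈⇒proper X₂ S X₂⊆S))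
    ... | true | false | false = begin
        2 ^ ∣ S ∣ + 2        ≡⟨ +-comm (2 ^ ∣ S ∣) 2 ⟩
        suc (suc (2 ^ ∣ S ∣)) ≤⟨ s≤s (≤∧≢⇒< (lower-proper S (x , lookup⇒[]= x S S∋x) (⊈⇒proper X₁ S X₁⊆S)) (≢-sym (no-critical S S∋x X₁⊆S X₂⊆S))) ⟩
        suc (sumOver S a)    ≡⟨ +-comm 1 _ ⟩
        sumOver S a + 1      ∎
      where open ≤-Reasoning

    hallCondition : HallCondition (nonemptySubsets n) a
    hallCondition S = +-cancelʳ-≤ 1 _ _ (begin
      demand (nonemptySubsets n) S + 1          ≤⟨ +-monoˡ-≤ 1 (demand-bound S) ⟩
      subsetsOf S + extras + 1                  ≡⟨ xy∙z≈xz∙y (subsetsOf S) extras 1 ⟩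
      subsetsOf S + 1 + extras                  ≡⟨ cong (_+ extras) (sum-nonemptySubsets-⊆ n S) ⟩
      2 ^ ∣ S ∣ + extras                        ≤⟨ extra-covered S ⟩
      sumOver S a + 1                           ∎)
      where
      open ≤-Reasoning
      extras = extra X₁ S + extra X₂ S

  allowed⇒choice : x ∈ X₁ → x ∈ X₂ → (ψ : Subset n → Fin n) →
                   (∀ X → X ∈ₗ nonemptySubsets n → lookup (allowed X) (ψ X) ≡ true) →
                   (Y : Subset n) → Y ≢ ∅ → lookup Y (ψ Y) ≡ true
  allowed⇒choice x∈X₁ x∈X₂ ψ ψ∈ Y Y≢∅ with ψ∈ Y (∈-nonemptySubsets n Y Y≢∅)
  ... | ψY∈ with eqSubset Y X₁ in Y≡X₁ | eqSubset Y X₂ in Y≡X₂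
  ...   | true | _ rewrite eqSubset-sound Y X₁ Y≡X₁ | x∈⁅y⁆⇒x≡y x (lookup⇒[]= (ψ X₁) ⁅ x ⁆ ψY∈) = []=⇒lookup x∈X₁
  ...   | false | true rewrite eqSubset-sound Y X₂ Y≡X₂ | x∈⁅y⁆⇒x≡y x (lookup⇒[]= (ψ X₂) ⁅ x ⁆ ψY∈) = []=⇒lookup x∈X₂
  ...   | false | false = ψY∈

  allowed-X₁ : (ψ : Subset n → Fin n) → lookup (allowed X₁) (ψ X₁) ≡ true → ψ X₁ ≡ x
  allowed-X₁ ψ ψX₁∈ rewrite eqSubset-refl X₁ = x∈⁅y⁆⇒x≡y x (lookup⇒[]= (ψ X₁) ⁅ x ⁆ ψX₁∈)

  allowed-X₂ : (ψ : Subset n → Fin n) → lookup (allowed X₂) (ψ X₂) ≡ true → ψ X₂ ≡ x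
  allowed-X₂ ψ ψX₂∈ rewrite eqSubset-refl X₂ | ∨-zeroʳ (eqSubset X₂ X₁) = x∈⁅y⁆⇒x≡y x (lookup⇒[]= (ψ X₂) ⁅ x ⁆ ψX₂∈)

  prescribedTree : x ∈ X₁ → x ∈ X₂ → X₁ ≢ ∅ → X₂ ≢ ∅ → (a : Fin n → ℕ) → HallCondition (nonemptySubsets n) a →
                   sumOver full a ≡ length (nonemptySubsets n) →
                   ∃ λ (T : EdgeSet n) → IsSpanningTree T × IsUpright T × ((i : Fin n) → sig T i ≡ a i) × PsiIs T X₁ x × PsiIs T X₂ x
  prescribedTree x∈X₁ x∈X₂ X₁≢∅ X₂≢∅ a hc total with hall x (nonemptySubsets n) (nonemptySubsets-unique n) a hc total
  ... | ψ , ψ∈ , load≡ = tree , tree-isSpanningTree , tree-isUpright , (λ i → trans (sig-tree i) (load≡ i)) ,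
        subst (PsiIs tree X₁) (allowed-X₁ ψ (ψ∈ X₁ (∈-nonemptySubsets n X₁ X₁≢∅))) (tree-psi X₁ X₁≢∅) ,
        subst (PsiIs tree X₂) (allowed-X₂ ψ (ψ∈ X₂ (∈-nonemptySubsets n X₂ X₂≢∅))) (tree-psi X₂ X₂≢∅)
    where open UprightTree (ψ , allowed⇒choice x∈X₁ x∈X₂ ψ ψ∈) using (tree; tree-isSpanningTree; tree-isUpright; sig-tree; tree-psi)

proposition5p10 : (n : ℕ) → 4 ≤ n → (a : Fin n → ℕ) →
    IsSignature a → IsOrdered a → IsIrreducible a →
    (X₁ X₂ : Subset n) → X₁ ≢ X₂ → Nonempty X₁ → Nonempty X₂ →
    (x : Fin n) → x ∈ X₁ → x ∈ X₂ → IsMax X₁ x ⊎ IsMax X₂ x →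
    ¬ Exceptional a X₁ X₂ x →
    ∃ λ (T : EdgeSet n) → IsSpanningTree T × IsUpright T ×
      ((i : Fin n) → sig T i ≡ a i) × PsiIs T X₁ x × PsiIs T X₂ x
proposition5p10 (suc (suc (suc m))) (s≤s (s≤s (s≤s _))) a signature ordered irreducible X₁ X₂ X₁≢X₂ X₁≠∅ X₂≠∅ x x∈X₁ x∈X₂ max ¬exceptional =
  prescribedTree x∈X₁ x∈X₂ (Nonempty⇒≢∅ X₁ X₁≠∅) (Nonempty⇒≢∅ X₂ X₂≠∅) a
    (hallCondition a (signature-lower signature) (irreducible-strict signature irreducible)
      (¬Exceptional⇒no-critical X₁≢X₂ x∈X₁ x∈X₂ max ¬exceptional))
    (signature-total signature)
  where
  open Prescribed X₁ X₂ x
  open CriticalSets a ordered (signature-≥2 signature ordered irreducible) (signature-lower signature) (signature-not-all≤2 signature)
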